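{- Let $n\ge2$. If $n$ is odd, the spectrum of $\mathcal{G}_4(n)$ is the multiset $-\mathrm{sp}_3(n)\cup\mathrm{sp}_3(n)$; if $3\nmid n$, the spectrum of $\mathcal{G}_6(n)$ is the multiset $-\mathrm{sp}_3(n)\cup\mathrm{sp}_3(n)$. Here $\cup$ is multiset union (multiplicities add).
   Context: $\mathcal{G}_3(n)$ (the underlying graph of the Farey map $\mathcal{M}_3(n)$) has vertices the pairs $(a,c)\in(\mathbb{Z}/n\mathbb{Z})^2$ with $\gcd(a,c,n)=1$ modulo $(a,c)\sim(-a,-c)$, written $[a/c]_n$, with $[a/c]_n$ and $[b/d]_n$ adjacent iff $ad-bc\equiv\pm1\pmod n$; $\mathrm{sp}_3(n)$ is the multiset of eigenvalues of its adjacency matrix, and $-S=\{(-\lambda)^{(m)}:\lambda^{(m)}\in S\}$. For odd $n$, $\mathcal{G}_4(n)$ (underlying graph of the Hecke map $\mathcal{M}_4(n)$) has even vertices $[a/c\sqrt2]_n$ and odd vertices $[b\sqrt2/d]_n$, each indexed by pairs in $(\mathbb{Z}/n\mathbb{Z})^2$ with $\gcd(\cdot,\cdot,n)=1$ modulo $\pm1$; $[a/c\sqrt2]_n$ and $[b\sqrt2/d]_n$ are adjacent iff $ad-2bc\equiv\pm1\pmod n$, and there are no other adjacencies. For $3\nmid n$, $\mathcal{G}_6(n)$ (underlying graph of $\mathcal{M}_6(n)$) is defined likewise with $\sqrt3$ in place of $\sqrt2$ and adjacency iff $ad-3bc\equiv\pm1\pmod n$. The spectrum of a graph is the multiset of eigenvalues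 of its adjacency matrix. -}

module Defs where

open import Data.Nat as ℕ using (ℕ; zero; suc; _%_; _<ᵇ_; _≡ᵇ_; _≤ᵇ_; _∸_)
open import Data.Nat.GCD using (gcd)
open import Data.Integer as ℤ using (ℤ; +_; -_)
open import Data.Bool using (Bool; true; false; if_then_else_; _∧_; _∨_)
open import Data.Fin using (Fin; zero; suc; punchIn; toℕ; splitAt; _≟_)
open import Data.List using (List; []; _∷_; map; concatMap; upTo; filterᵇ; length; lookup)
open import Data.Product using (_×_; _,_; proj₁; proj₂)
open import Data.Sum using (inj₁; inj₂)
open import Relation.Nullary.Decidable using (⌊_⌋)
open import Relation.Binary.PropositionalEquality using (_≡_)

-- Polynomials over ℤ: coefficient lists, lowest degree first.

Poly : Set
Poly = List ℤ

coeff : Poly → ℕ → ℤ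
coeff []       _       = + 0
coeff (a ∷ p)  zero    = a
coeff (a ∷ p)  (suc k) = coeff p k

-- equality of polynomials (coefficientwise; trailing zeros irrelevant)
_≈P_ : Poly → Poly → Set
p ≈P q = ∀ k → coeff p k ≡ coeff q k

infix 4 _≈P_

_+P_ : Poly → Poly → Poly
[]      +P q       = q
(a ∷ p) +P []      = a ∷ p
(a ∷ p) +P (b ∷ q) = (a ℤ.+ b) ∷ (p +P q)

scaleP : ℤ → Poly → Poly
scaleP c = map (c ℤ.*_)

negP : Poly → Poly
negP = map -_

_*P_ : Poly → Poly → Poly
[]      *P q = []
(a ∷ p) *P q = scaleP a q +P (+ 0 ∷ (p *P q))

constP : ℤ → Poly
constP c = c ∷ []

xP : Poly
xP = + 0 ∷ + 1 ∷ []

negArg : Poly → Poly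
negArg []      = []
negArg (a ∷ p) = a ∷ negP (negArg p)

signℤ : ℕ → ℤ
signℤ zero    = + 1
signℤ (suc m) = - signℤ m

sumP : ∀ m → (Fin m → Poly) → Poly
sumP zero    f = []
sumP (suc m) f = f zero +P sumP m (λ j → f (suc j))

det : ∀ m → (Fin m → Fin m → Poly) → Poly
det zero    M = constP (+ 1)
det (suc m) M =
  sumP (suc m) (λ j → scaleP (signℤ (toℕ j))
                         (M zero j *P det m (λ i k → M (suc i) (punchIn j k))))

record Graph : Set where
  field
    V   : ℕ
    adj : Fin V → Fin V → Bool

open Graph public

adjℤ : (G : Graph) → Fin (V G) → Fin (V G) → ℤ
adjℤ G i j = if adj G i j then + 1 else + 0

charPoly : Graph → Poly
charPoly G = det (V G) (λ i j →
  (if ⌊ i ≟ j ⌋ then xP else []) +P constP (- adjℤ G i j))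

-- The spectrum (multiset of eigenvalues, with multiplicities) of a graph
-- on V vertices is encoded by the monic degree-V polynomial whose roots
-- (with multiplicity) are exactly those eigenvalues, i.e. charPoly.
-- Multisets S of V numbers are encoded as  ∏_{λ ∈ S} (x - λ).
Spectrum : Set
Spectrum = Poly

sp : Graph → Spectrum
sp = charPoly

-- encoding of -S, for a multiset S of size m:  ∏ (x + λ) = (-1)^m S(-x)
negSpec : ℕ → Spectrum → Spectrum
negSpec m s = scaleP (signℤ m) (negArg s)

-- multiset union (multiplicities add) = product of encodings
_∪S_ : Spectrum → Spectrum → Spectrum
_∪S_ = _*P_

_≈S_ : Spectrum → Spectrum → Set
_≈S_ = _≈P_

-- Vertices: pairs (a,c) ∈ (ℤ/nℤ)² (representatives 0 ≤ a,c < n) with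
-- gcd(a,c,n) = 1, modulo (a,c) ~ (-a,-c); each class is represented by
-- its lexicographically smallest member.

modN : ℕ → ℕ → ℕ
modN zero    x = x
modN (suc k) x = x % suc k

negN : ℕ → ℕ → ℕ
negN n a = modN n (n ∸ a)

lexLe : ℕ × ℕ → ℕ × ℕ → Bool
lexLe (a , c) (a' , c') = (a <ᵇ a') ∨ ((a ≡ᵇ a') ∧ (c ≤ᵇ c'))

isCanonical : ℕ → ℕ × ℕ → Bool
isCanonical n (a , c) =
  (gcd (gcd a c) n ≡ᵇ 1) ∧ lexLe (a , c) (negN n a , negN n c)

allPairs : ℕ → List (ℕ × ℕ)
allPairs n = concatMap (λ a → map (λ c → (a , c)) (upTo n)) (upTo n)

vertexList : ℕ → List (ℕ × ℕ)
vertexList n = filterᵇ (isCanonical n) (allPairs n)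

N : ℕ → ℕ
N n = length (vertexList n)

vtx : (n : ℕ) → Fin (N n) → ℕ × ℕ
vtx n = lookup (vertexList n)

isUnitSign : ℕ → ℕ → Bool
isUnitSign n x = (modN n x ≡ᵇ modN n 1) ∨ (modN n x ≡ᵇ modN n (n ∸ 1))

-- a*d - k*b*c ≡ ±1 (mod n), computed as a*d + (n-1)*k*b*c  (n ≥ 1)
detCond : ℕ → ℕ → ℕ × ℕ → ℕ × ℕ → Bool
detCond n k (a , c) (b , d) =
  isUnitSign n (a ℕ.* d ℕ.+ (n ∸ 1) ℕ.* (k ℕ.* (b ℕ.* c)))

G3 : ℕ → Graph
G3 n = record { V = N n ; adj = λ i j → detCond n 1 (vtx n i) (vtx n j) }

-- Bipartite graph with even vertices [a/c√k] (first N n indices) and odd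
-- vertices [b√k/d] (last N n indices); [a/c√k] ~ [b√k/d] iff
-- ad - k bc ≡ ±1 (mod n); no other adjacencies.
Gk : ℕ → ℕ → Graph
Gk k n = record { V = N n ℕ.+ N n ; adj = A }
  where
  A : Fin (N n ℕ.+ N n) → Fin (N n ℕ.+ N n) → Bool
  A i j with splitAt (N n) i | splitAt (N n) j
  ... | inj₁ e | inj₂ o = detCond n k (vtx n e) (vtx n o)
  ... | inj₂ o | inj₁ e = detCond n k (vtx n e) (vtx n o)
  ... | _      | _      = false

G4 : ℕ → Graph
G4 = Gk 2

G6 : ℕ → Graph
G6 = Gk 3

sp3 : ℕ → Spectrum
sp3 n = sp (G3 n)

{-# OPTIONS --safe #-}
-- Write χ for the characteristic polynomial of G₃(n) and A for its (symmetric) adjacency matrix.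
-- Let k = 2 for G₄(n) and k = 3 for G₆(n). Then k is invertible modulo n, and [b/d] ↦ [k⁻¹b√k/d]
-- is a bijection from the vertices of G₃(n) onto the odd vertices of G_k(n); since
-- ad − k(k⁻¹b)c ≡ ad − bc, it carries the adjacency of G₃(n) to that of G_k(n). So after
-- relabelling, t − Adj(G_k(n)) is the block matrix [[t, −A], [−A, t]]; adding the lower block
-- rows to the upper ones and then subtracting the left block columns from the right ones makes
-- it [[t − A, 0], [−A, t + A]], whence det (t − Adj(G_k(n))) = det (t − A) · det (t + A),
-- which is (−1)^N χ(−t) χ(t). Both sides are integer polynomials agreeing at every integer t.
module Submission where

open import Defs
open import Data.Nat using (ℕ; _≤_)
open import Data.Nat.Divisibility using (_∣_)
open import Data.Product using (_×_)
open import Relation.Nullary using (¬_)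

module Determinant where

  open import Data.Nat as ℕ using (ℕ; zero; suc)
  open import Data.Integer using (ℤ; +0; +[1+_]; -[1+_]; -_; _+_; _*_; 0ℤ; 1ℤ)
  import Data.Integer.Properties as ℤ
  open import Data.Integer.Solver using (module +-*-Solver)
  open import Data.Fin using (Fin; zero; suc; punchIn; punchOut; toℕ; inject₁; _↑ˡ_; _↑ʳ_; _≟_; splitAt)
  open import Data.Fin.Properties
    using (splitAt-↑ˡ; splitAt-↑ʳ; toℕ-↑ˡ; toℕ-inject₁; suc-injective;
           punchIn-injective; punchInᵢ≢i; punchIn-punchOut; punchOut-punchIn; punchOut-cong)
  open import Data.Product using (Σ-syntax; _×_; _,_; proj₁; proj₂)
  open import Data.Sum as Sum using (_⊎_; inj₁; inj₂)
  open import Function using (_∘_; id)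
  open import Function.Definitions using (Injective)
  open import Data.List using (List; []; _∷_; map; _++_)
  open import Relation.Binary.PropositionalEquality
  open import Relation.Nullary using (yes; no)
  open import Data.Empty using (⊥-elim)
  open import Algebra.Properties.Semiring.Sum ℤ.+-*-semiring
    using (sum; sum-cong-≗; ∑-distrib-+; ∑-comm; sum-remove; *-distribˡ-sum; sum-replicate-zero)
  open +-*-Solver using (solve; _:+_; _:*_; :-_; _:=_; con)

  sum-neg : ∀ {m} (f : Fin m → ℤ) → sum (λ j → - f j) ≡ - sum f
  sum-neg {zero}  f = refl
  sum-neg {suc m} f = trans (cong (- f zero +_) (sum-neg (f ∘ suc))) (sym (ℤ.neg-distrib-+ (f zero) _))

  sum-zero : ∀ {m} (f : Fin m → ℤ) → (∀ j → f j ≡ 0ℤ) → sum f ≡ 0ℤ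
  sum-zero {m} f f≗0 = trans (sum-cong-≗ f≗0) (sum-replicate-zero m)

  sum-splitAt : ∀ a {b} (f : Fin (a ℕ.+ b) → ℤ) → sum f ≡ sum (λ i → f (i ↑ˡ b)) + sum (λ j → f (a ↑ʳ j))
  sum-splitAt zero    f = sym (ℤ.+-identityˡ _)
  sum-splitAt (suc a) f = trans (cong (f zero +_) (sum-splitAt a (f ∘ suc))) (sym (ℤ.+-assoc (f zero) _ _))

  Matrix : ℕ → Set
  Matrix m = Fin m → Fin m → ℤ

  sign : ∀ {m} → Fin m → ℤ
  sign j = signℤ (toℕ j)

  minor : ∀ {m} → Matrix (suc m) → Fin (suc m) → Matrix m
  minor M j i k = M (suc i) (punchIn j k)

  detℤ : ∀ m → Matrix m → ℤ

  laplaceTerm : ∀ {m} → Matrix (suc m) → Fin (suc m) → ℤ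
  laplaceTerm {m} M j = sign j * (M zero j * detℤ m (minor M j))

  detℤ zero    M = 1ℤ
  detℤ (suc m) M = sum (laplaceTerm M)

  det-cong : ∀ m {M M′ : Matrix m} → (∀ i j → M i j ≡ M′ i j) → detℤ m M ≡ detℤ m M′
  det-cong zero    M≡M′ = refl
  det-cong (suc m) M≡M′ = sum-cong-≗ λ j →
    cong₂ (λ x y → sign j * (x * y)) (M≡M′ zero j) (det-cong m (λ i k → M≡M′ (suc i) (punchIn j k)))

  det-additive-termwise : ∀ {m} (M M₁ M₂ : Matrix (suc m)) →
    (∀ j → laplaceTerm M j ≡ laplaceTerm M₁ j + laplaceTerm M₂ j) →
    detℤ (suc m) M ≡ detℤ (suc m) M₁ + detℤ (suc m) M₂
  det-additive-termwise M M₁ M₂ h = trans (sum-cong-≗ h) (∑-distrib-+ (laplaceTerm M₁) (laplaceTerm M₂))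

  laplaceTerm-additive-entry : ∀ {m} (M M₁ M₂ : Matrix (suc m)) j →
    M zero j ≡ M₁ zero j + M₂ zero j →
    detℤ m (minor M₁ j) ≡ detℤ m (minor M j) → detℤ m (minor M₂ j) ≡ detℤ m (minor M j) →
    laplaceTerm M j ≡ laplaceTerm M₁ j + laplaceTerm M₂ j
  laplaceTerm-additive-entry M M₁ M₂ j e d₁ d₂ rewrite e | d₁ | d₂ =
    solve 4 (λ s a b d → s :* ((a :+ b) :* d) := s :* (a :* d) :+ s :* (b :* d)) refl (sign j) (M₁ zero j) (M₂ zero j) _

  laplaceTerm-additive-minor : ∀ {m} (M M₁ M₂ : Matrix (suc m)) j →
    M₁ zero j ≡ M zero j → M₂ zero j ≡ M zero j → detℤ m (minor M j) ≡ detℤ m (minor M₁ j) + detℤ m (minor M₂ j) →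
    laplaceTerm M j ≡ laplaceTerm M₁ j + laplaceTerm M₂ j
  laplaceTerm-additive-minor M M₁ M₂ j e₁ e₂ d rewrite e₁ | e₂ | d =
    solve 4 (λ s a b c → s :* (a :* (b :+ c)) := s :* (a :* b) :+ s :* (a :* c)) refl (sign j) (M zero j) _ _

  det-additive-row : ∀ m (r : Fin m) {M M₁ M₂ : Matrix m} →
    (∀ i → i ≢ r → M₁ i ≗ M i) → (∀ i → i ≢ r → M₂ i ≗ M i) →
    (∀ j → M r j ≡ M₁ r j + M₂ r j) → detℤ m M ≡ detℤ m M₁ + detℤ m M₂
  det-additive-row (suc m) zero {M} {M₁} {M₂} h₁ h₂ hr = det-additive-termwise M M₁ M₂ λ j →
    laplaceTerm-additive-entry M M₁ M₂ j (hr j)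
      (det-cong m (λ i k → h₁ (suc i) (λ ()) (punchIn j k))) (det-cong m (λ i k → h₂ (suc i) (λ ()) (punchIn j k)))
  det-additive-row (suc m) (suc r) {M} {M₁} {M₂} h₁ h₂ hr = det-additive-termwise M M₁ M₂ λ j →
    laplaceTerm-additive-minor M M₁ M₂ j (h₁ zero (λ ()) j) (h₂ zero (λ ()) j)
      (det-additive-row m r (λ i i≢r k → h₁ (suc i) (i≢r ∘ suc-injective) (punchIn j k))
                            (λ i i≢r k → h₂ (suc i) (i≢r ∘ suc-injective) (punchIn j k)) (hr ∘ punchIn j))

  det-additive-col : ∀ m (c : Fin m) {M M₁ M₂ : Matrix m} →
    (∀ i j → j ≢ c → M₁ i j ≡ M i j) → (∀ i j → j ≢ c → M₂ i j ≡ M i j) →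
    (∀ i → M i c ≡ M₁ i c + M₂ i c) → detℤ m M ≡ detℤ m M₁ + detℤ m M₂
  det-additive-col (suc m) c {M} {M₁} {M₂} h₁ h₂ hc = det-additive-termwise M M₁ M₂ term
    where
    term : ∀ j → laplaceTerm M j ≡ laplaceTerm M₁ j + laplaceTerm M₂ j
    term j with j ≟ c
    ... | yes refl = laplaceTerm-additive-entry M M₁ M₂ j (hc zero)
      (det-cong m (λ i k → h₁ (suc i) (punchIn j k) (punchInᵢ≢i j k)))
      (det-cong m (λ i k → h₂ (suc i) (punchIn j k) (punchInᵢ≢i j k)))
    ... | no j≢c = laplaceTerm-additive-minor M M₁ M₂ j (h₁ zero j j≢c) (h₂ zero j j≢c)
      (det-additive-col m (punchOut j≢c) (λ i k → h₁ (suc i) (punchIn j k) ∘ away k)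
                                         (λ i k → h₂ (suc i) (punchIn j k) ∘ away k)
        (λ i → subst (λ z → M (suc i) z ≡ M₁ (suc i) z + M₂ (suc i) z) (sym (punchIn-punchOut j≢c)) (hc (suc i))))
      where
      away : ∀ k → k ≢ punchOut j≢c → punchIn j k ≢ c
      away k k≢c′ e = k≢c′ (punchIn-injective j k _ (trans e (sym (punchIn-punchOut j≢c))))

  adjSwap : ∀ {m} → Fin m → Fin (suc m) → Fin (suc m)
  adjSwap zero    zero          = suc zero
  adjSwap zero    (suc zero)    = zero
  adjSwap zero    (suc (suc i)) = suc (suc i)
  adjSwap (suc k) zero          = zero
  adjSwap (suc k) (suc i)       = suc (adjSwap k i)

  sum-adjSwap : ∀ {m} (k : Fin m) (f : Fin (suc m) → ℤ) → sum (f ∘ adjSwap k) ≡ sum f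
  sum-adjSwap {suc m} zero    f = solve 3 (λ a b c → b :+ (a :+ c) := a :+ (b :+ c)) refl (f zero) (f (suc zero)) _
  sum-adjSwap {suc m} (suc k) f = cong (f zero +_) (sum-adjSwap k (f ∘ suc))

  adjSwap-inject₁ : ∀ {m} (k : Fin m) → adjSwap k (inject₁ k) ≡ suc k
  adjSwap-inject₁ zero    = refl
  adjSwap-inject₁ (suc k) = cong suc (adjSwap-inject₁ k)

  adjSwap-suc : ∀ {m} (k : Fin m) → adjSwap k (suc k) ≡ inject₁ k
  adjSwap-suc zero    = refl
  adjSwap-suc (suc k) = cong suc (adjSwap-suc k)

  adjSwap-punchIn-inject₁ : ∀ {m} (k : Fin m) l → adjSwap k (punchIn (inject₁ k) l) ≡ punchIn (suc k) l
  adjSwap-punchIn-inject₁ zero    zero    = refl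
  adjSwap-punchIn-inject₁ zero    (suc l) = refl
  adjSwap-punchIn-inject₁ (suc k) zero    = refl
  adjSwap-punchIn-inject₁ (suc k) (suc l) = cong suc (adjSwap-punchIn-inject₁ k l)

  adjSwap-punchIn-suc : ∀ {m} (k : Fin m) l → adjSwap k (punchIn (suc k) l) ≡ punchIn (inject₁ k) l
  adjSwap-punchIn-suc zero    zero    = refl
  adjSwap-punchIn-suc zero    (suc l) = refl
  adjSwap-punchIn-suc (suc k) zero    = refl
  adjSwap-punchIn-suc (suc k) (suc l) = cong suc (adjSwap-punchIn-suc k l)

  adjSwap-punchIn-elsewhere : ∀ {m} (k : Fin (suc m)) j → j ≢ inject₁ k → j ≢ suc k →
    (adjSwap k j ≡ j) × Σ[ k′ ∈ Fin m ] (∀ l → adjSwap k (punchIn j l) ≡ punchIn j (adjSwap k′ l))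
  adjSwap-punchIn-elsewhere zero zero j≢k _ = ⊥-elim (j≢k refl)
  adjSwap-punchIn-elsewhere zero (suc zero) _ j≢k+1 = ⊥-elim (j≢k+1 refl)
  adjSwap-punchIn-elsewhere {suc m} zero (suc (suc j)) _ _ =
    refl , zero , λ { zero → refl ; (suc zero) → refl ; (suc (suc l)) → refl }
  adjSwap-punchIn-elsewhere {suc m} (suc k) zero _ _ = refl , k , λ l → refl
  adjSwap-punchIn-elsewhere {suc m} (suc k) (suc j) j≢k j≢k+1
    with adjSwap-punchIn-elsewhere k j (j≢k ∘ cong suc) (j≢k+1 ∘ cong suc)
  ... | fixed , k′ , commute = cong suc fixed , suc k′ , λ { zero → refl ; (suc l) → cong suc (commute l) }

  sign-inject₁ : ∀ {m} (k : Fin m) → sign (inject₁ k) ≡ sign k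
  sign-inject₁ k = cong signℤ (toℕ-inject₁ k)

  det-swap-adjacent-cols : ∀ m (k : Fin m) (M : Matrix (suc m)) →
    detℤ (suc m) (λ i j → M i (adjSwap k j)) ≡ - detℤ (suc m) M
  det-swap-adjacent-cols (suc m) k M = begin
    sum (laplaceTerm M′)                         ≡⟨ sum-cong-≗ term ⟩
    sum (λ j → - laplaceTerm M (adjSwap k j))    ≡⟨ sum-neg (laplaceTerm M ∘ adjSwap k) ⟩
    - sum (laplaceTerm M ∘ adjSwap k)            ≡⟨ cong -_ (sum-adjSwap k (laplaceTerm M)) ⟩
    - sum (laplaceTerm M)                        ∎
    where
    open ≡-Reasoning
    M′ : Matrix (suc (suc m))
    M′ i j = M i (adjSwap k j)
    term : ∀ j → laplaceTerm M′ j ≡ - laplaceTerm M (adjSwap k j)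
    term j with j ≟ inject₁ k
    ... | yes refl rewrite adjSwap-inject₁ k | det-cong (suc m) (λ i l → cong (M (suc i)) (adjSwap-punchIn-inject₁ k l))
                         | sign-inject₁ k =
      solve 2 (λ s x → s :* x := :- (:- s :* x)) refl (sign k) _
    ... | no j≢k with j ≟ suc k
    ... | yes refl rewrite adjSwap-suc k | det-cong (suc m) (λ i l → cong (M (suc i)) (adjSwap-punchIn-suc k l))
                         | sign-inject₁ k =
      solve 2 (λ s x → :- s :* x := :- (s :* x)) refl (sign k) _
    ... | no j≢k+1 with adjSwap-punchIn-elsewhere k j j≢k j≢k+1
    ... | fixed , k′ , commute rewrite fixed | det-cong (suc m) (λ i l → cong (M (suc i)) (commute l))
                                     | det-swap-adjacent-cols m k′ (minor M j) =
      solve 3 (λ s a d → s :* (a :* :- d) := :- (s :* (a :* d))) refl (sign j) (M zero j) _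

  punchIn-punchOut-comm : ∀ {m} (a c : Fin (suc (suc m))) (a≢c : a ≢ c) (c≢a : c ≢ a) l →
    punchIn a (punchIn (punchOut a≢c) l) ≡ punchIn c (punchIn (punchOut c≢a) l)
  punchIn-punchOut-comm zero zero a≢c _ l = ⊥-elim (a≢c refl)
  punchIn-punchOut-comm zero (suc c) _ _ l = refl
  punchIn-punchOut-comm (suc a) zero _ _ l = refl
  punchIn-punchOut-comm {zero} (suc zero) (suc zero) a≢c _ l = ⊥-elim (a≢c refl)
  punchIn-punchOut-comm {suc m} (suc a) (suc c) _ _ zero = refl
  punchIn-punchOut-comm {suc m} (suc a) (suc c) a≢c c≢a (suc l) =
    cong suc (punchIn-punchOut-comm a c (a≢c ∘ cong suc) (c≢a ∘ cong suc) l)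

  sign-punchOut-antisym : ∀ {m} (a c : Fin (suc (suc m))) (a≢c : a ≢ c) (c≢a : c ≢ a) →
    sign a * sign (punchOut a≢c) ≡ - (sign c * sign (punchOut c≢a))
  sign-punchOut-antisym zero zero a≢c _ = ⊥-elim (a≢c refl)
  sign-punchOut-antisym zero (suc c) _ _ = solve 1 (λ s → con 1ℤ :* s := :- (:- s :* con 1ℤ)) refl (sign c)
  sign-punchOut-antisym (suc a) zero _ _ = solve 1 (λ s → :- s :* con 1ℤ := :- (con 1ℤ :* s)) refl (sign a)
  sign-punchOut-antisym {zero} (suc zero) (suc zero) a≢c _ = ⊥-elim (a≢c refl)
  sign-punchOut-antisym {suc m} (suc a) (suc c) a≢c c≢a = begin
    - sign a * - sign (punchOut (a≢c ∘ cong suc))       ≡⟨ negs (sign a) _ ⟩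
    sign a * sign (punchOut (a≢c ∘ cong suc))           ≡⟨ sign-punchOut-antisym a c (a≢c ∘ cong suc) (c≢a ∘ cong suc) ⟩
    - (sign c * sign (punchOut (c≢a ∘ cong suc)))       ≡⟨ cong -_ (sym (negs (sign c) _)) ⟩
    - (- sign c * - sign (punchOut (c≢a ∘ cong suc)))   ∎
    where
    open ≡-Reasoning
    negs : ∀ x y → - x * - y ≡ x * y
    negs = solve 2 (λ x y → :- x :* :- y := x :* y) refl

  -- Expanding along the first two rows gives det = Σ r₀ a · r₁ c · pairCoeff a c with pairCoeff
  -- antisymmetric, so exchanging the first two rows negates the determinant.
  module TopTwoRows {m : ℕ} (R : Fin m → Fin (suc (suc m)) → ℤ) where

    withTopRows : (Fin (suc (suc m)) → ℤ) → (Fin (suc (suc m)) → ℤ) → Matrix (suc (suc m))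
    withTopRows r₀ r₁ zero          = r₀
    withTopRows r₀ r₁ (suc zero)    = r₁
    withTopRows r₀ r₁ (suc (suc i)) = R i

    pairMinor : Fin (suc (suc m)) → Fin (suc m) → ℤ
    pairMinor a b = detℤ m (λ i l → R i (punchIn a (punchIn b l)))

    pairCoeff : Fin (suc (suc m)) → Fin (suc (suc m)) → ℤ
    pairCoeff a c with a ≟ c
    ... | yes _   = 0ℤ
    ... | no a≢c = sign a * sign (punchOut a≢c) * pairMinor a (punchOut a≢c)

    pairCoeff-diag : ∀ a → pairCoeff a a ≡ 0ℤ
    pairCoeff-diag a with a ≟ a
    ... | yes _   = refl
    ... | no a≢a = ⊥-elim (a≢a refl)

    pairCoeff-punchIn : ∀ a b → pairCoeff a (punchIn a b) ≡ sign a * sign b * pairMinor a b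
    pairCoeff-punchIn a b with a ≟ punchIn a b
    ... | yes a≡ = ⊥-elim (punchInᵢ≢i a b (sym a≡))
    ... | no a≢ = cong (λ b′ → sign a * sign b′ * pairMinor a b′)
                    (trans (punchOut-cong a {i≢k = punchInᵢ≢i a b ∘ sym} refl) (punchOut-punchIn a))

    pairCoeff-antisym : ∀ a c → pairCoeff c a ≡ - pairCoeff a c
    pairCoeff-antisym a c with a ≟ c | c ≟ a
    ... | yes _   | yes _   = refl
    ... | yes a≡c | no c≢a = ⊥-elim (c≢a (sym a≡c))
    ... | no a≢c | yes c≡a = ⊥-elim (a≢c (sym c≡a))
    ... | no a≢c | no c≢a rewrite sign-punchOut-antisym a c a≢c c≢a
                                 | det-cong m (λ i l → cong (R i) (punchIn-punchOut-comm a c a≢c c≢a l)) =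
      solve 2 (λ x d → x :* d := :- (:- x :* d)) refl (sign c * sign (punchOut c≢a)) _

    det-withTopRows : ∀ r₀ r₁ →
      detℤ (suc (suc m)) (withTopRows r₀ r₁) ≡ sum (λ a → sum (λ c → r₀ a * (r₁ c * pairCoeff a c)))
    det-withTopRows r₀ r₁ = sum-cong-≗ λ a → begin
      sign a * (r₀ a * sum (λ b → sign b * (r₁ (punchIn a b) * pairMinor a b)))
        ≡⟨ solve 3 (λ s r x → s :* (r :* x) := (s :* r) :* x) refl (sign a) (r₀ a) _ ⟩
      sign a * r₀ a * sum (λ b → sign b * (r₁ (punchIn a b) * pairMinor a b))
        ≡⟨ *-distribˡ-sum (sign a * r₀ a) (λ b → sign b * (r₁ (punchIn a b) * pairMinor a b)) ⟩
      sum (λ b → sign a * r₀ a * (sign b * (r₁ (punchIn a b) * pairMinor a b)))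
        ≡⟨ sum-cong-≗ (regroup a) ⟩
      sum (λ b → r₀ a * (r₁ (punchIn a b) * pairCoeff a (punchIn a b)))
        ≡⟨ sym (ℤ.+-identityˡ _) ⟩
      0ℤ + sum (λ b → r₀ a * (r₁ (punchIn a b) * pairCoeff a (punchIn a b)))
        ≡⟨ cong (_+ sum (λ b → r₀ a * (r₁ (punchIn a b) * pairCoeff a (punchIn a b)))) (sym (diagonal a)) ⟩
      r₀ a * (r₁ a * pairCoeff a a) + sum (λ b → r₀ a * (r₁ (punchIn a b) * pairCoeff a (punchIn a b)))
        ≡⟨ sym (sum-remove {i = a} (λ c → r₀ a * (r₁ c * pairCoeff a c))) ⟩
      sum (λ c → r₀ a * (r₁ c * pairCoeff a c)) ∎
      where
      open ≡-Reasoning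
      regroup : ∀ a b → sign a * r₀ a * (sign b * (r₁ (punchIn a b) * pairMinor a b))
                      ≡ r₀ a * (r₁ (punchIn a b) * pairCoeff a (punchIn a b))
      regroup a b rewrite pairCoeff-punchIn a b =
        solve 5 (λ s r t q d → s :* r :* (t :* (q :* d)) := r :* (q :* (s :* t :* d)))
          refl (sign a) (r₀ a) (sign b) (r₁ (punchIn a b)) _
      diagonal : ∀ a → r₀ a * (r₁ a * pairCoeff a a) ≡ 0ℤ
      diagonal a rewrite pairCoeff-diag a | ℤ.*-zeroʳ (r₁ a) = ℤ.*-zeroʳ (r₀ a)

    det-withTopRows-swap : ∀ r₀ r₁ → detℤ (suc (suc m)) (withTopRows r₁ r₀) ≡ - detℤ (suc (suc m)) (withTopRows r₀ r₁)
    det-withTopRows-swap r₀ r₁ = begin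
      detℤ (suc (suc m)) (withTopRows r₁ r₀)                  ≡⟨ det-withTopRows r₁ r₀ ⟩
      sum (λ a → sum (λ c → r₁ a * (r₀ c * pairCoeff a c)))   ≡⟨ ∑-comm (λ a c → r₁ a * (r₀ c * pairCoeff a c)) ⟩
      sum (λ c → sum (λ a → r₁ a * (r₀ c * pairCoeff a c)))   ≡⟨ sum-cong-≗ (λ c → sum-cong-≗ (antisym c)) ⟩
      sum (λ c → sum (λ a → - (r₀ c * (r₁ a * pairCoeff c a)))) ≡⟨ sum-cong-≗ (λ c → sum-neg (term c)) ⟩
      sum (λ c → - sum (λ a → r₀ c * (r₁ a * pairCoeff c a)))  ≡⟨ sum-neg (λ c → sum (term c)) ⟩
      - sum (λ c → sum (λ a → r₀ c * (r₁ a * pairCoeff c a)))  ≡⟨ cong -_ (sym (det-withTopRows r₀ r₁)) ⟩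
      - detℤ (suc (suc m)) (withTopRows r₀ r₁)                ∎
      where
      open ≡-Reasoning
      term : Fin (suc (suc m)) → Fin (suc (suc m)) → ℤ
      term c a = r₀ c * (r₁ a * pairCoeff c a)
      antisym : ∀ c a → r₁ a * (r₀ c * pairCoeff a c) ≡ - (r₀ c * (r₁ a * pairCoeff c a))
      antisym c a rewrite pairCoeff-antisym a c =
        solve 3 (λ x y e → x :* (y :* e) := :- (y :* (x :* :- e))) refl (r₁ a) (r₀ c) (pairCoeff a c)

  det-swap-adjacent-rows : ∀ m (k : Fin m) (M : Matrix (suc m)) →
    detℤ (suc m) (λ i → M (adjSwap k i)) ≡ - detℤ (suc m) M
  det-swap-adjacent-rows (suc m) zero M = begin
    detℤ (suc (suc m)) (λ i → M (adjSwap zero i))           ≡⟨ det-cong (suc (suc m)) swapped ⟩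
    detℤ (suc (suc m)) (withTopRows (M (suc zero)) (M zero)) ≡⟨ det-withTopRows-swap (M zero) (M (suc zero)) ⟩
    - detℤ (suc (suc m)) (withTopRows (M zero) (M (suc zero))) ≡⟨ cong -_ (det-cong (suc (suc m)) unswapped) ⟩
    - detℤ (suc (suc m)) M                                   ∎
    where
    open ≡-Reasoning
    open TopTwoRows (λ i → M (suc (suc i)))
    swapped : ∀ i j → M (adjSwap zero i) j ≡ withTopRows (M (suc zero)) (M zero) i j
    swapped zero          j = refl
    swapped (suc zero)    j = refl
    swapped (suc (suc i)) j = refl
    unswapped : ∀ i j → withTopRows (M zero) (M (suc zero)) i j ≡ M i j
    unswapped zero          j = refl
    unswapped (suc zero)    j = refl
    unswapped (suc (suc i)) j = refl
  det-swap-adjacent-rows (suc m) (suc k) M = trans (sum-cong-≗ term) (sum-neg (laplaceTerm M))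
    where
    term : ∀ j → laplaceTerm (λ i → M (adjSwap (suc k) i)) j ≡ - laplaceTerm M j
    term j rewrite det-swap-adjacent-rows m k (minor M j) =
      solve 3 (λ s a d → s :* (a :* :- d) := :- (s :* (a :* d))) refl (sign j) (M zero j) _

  det-conj-adjSwap : ∀ m (k : Fin m) (M : Matrix (suc m)) →
    detℤ (suc m) (λ i j → M (adjSwap k i) (adjSwap k j)) ≡ detℤ (suc m) M
  det-conj-adjSwap m k M = begin
    detℤ (suc m) (λ i j → M (adjSwap k i) (adjSwap k j)) ≡⟨ det-swap-adjacent-rows m k (λ i j → M i (adjSwap k j)) ⟩
    - detℤ (suc m) (λ i j → M i (adjSwap k j))           ≡⟨ cong -_ (det-swap-adjacent-cols m k M) ⟩
    - - detℤ (suc m) M                                   ≡⟨ ℤ.neg-involutive _ ⟩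
    detℤ (suc m) M                                       ∎
    where open ≡-Reasoning

  applySwaps : ∀ {m} → List (Fin m) → Fin (suc m) → Fin (suc m)
  applySwaps []       i = i
  applySwaps (k ∷ ks) i = adjSwap k (applySwaps ks i)

  det-conj-applySwaps : ∀ m ks (M : Matrix (suc m)) →
    detℤ (suc m) (λ i j → M (applySwaps ks i) (applySwaps ks j)) ≡ detℤ (suc m) M
  det-conj-applySwaps m []       M = refl
  det-conj-applySwaps m (k ∷ ks) M =
    trans (det-conj-applySwaps m ks (λ i j → M (adjSwap k i) (adjSwap k j))) (det-conj-adjSwap m k M)

  applySwaps-++ : ∀ {m} (ks ls : List (Fin m)) i → applySwaps (ks ++ ls) i ≡ applySwaps ks (applySwaps ls i)
  applySwaps-++ []       ls i = refl
  applySwaps-++ (k ∷ ks) ls i = cong (adjSwap k) (applySwaps-++ ks ls i)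

  applySwaps-map-suc-zero : ∀ {m} (ks : List (Fin m)) → applySwaps (map suc ks) zero ≡ zero
  applySwaps-map-suc-zero []       = refl
  applySwaps-map-suc-zero (k ∷ ks) rewrite applySwaps-map-suc-zero ks = refl

  applySwaps-map-suc : ∀ {m} (ks : List (Fin m)) i → applySwaps (map suc ks) (suc i) ≡ suc (applySwaps ks i)
  applySwaps-map-suc []       i = refl
  applySwaps-map-suc (k ∷ ks) i rewrite applySwaps-map-suc ks i = refl

  cycleTo : ∀ {m} → Fin (suc m) → List (Fin m)
  cycleTo zero            = []
  cycleTo {suc m} (suc p) = map suc (cycleTo p) ++ (zero ∷ [])

  applySwaps-cycleTo-zero : ∀ {m} (p : Fin (suc m)) → applySwaps (cycleTo p) zero ≡ p
  applySwaps-cycleTo-zero zero            = refl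
  applySwaps-cycleTo-zero {suc m} (suc p) =
    trans (applySwaps-++ (map suc (cycleTo p)) (zero ∷ []) zero)
          (trans (applySwaps-map-suc (cycleTo p) zero) (cong suc (applySwaps-cycleTo-zero p)))

  applySwaps-cycleTo-suc : ∀ {m} (p : Fin (suc m)) i → applySwaps (cycleTo p) (suc i) ≡ punchIn p i
  applySwaps-cycleTo-suc zero            i       = refl
  applySwaps-cycleTo-suc {suc m} (suc p) zero    =
    trans (applySwaps-++ (map suc (cycleTo p)) (zero ∷ []) (suc zero)) (applySwaps-map-suc-zero (cycleTo p))
  applySwaps-cycleTo-suc {suc m} (suc p) (suc i) =
    trans (applySwaps-++ (map suc (cycleTo p)) (zero ∷ []) (suc (suc i)))
          (trans (applySwaps-map-suc (cycleTo p) (suc i)) (cong suc (applySwaps-cycleTo-suc p i)))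

  insertSwaps : ∀ {m} → Fin (suc (suc m)) → List (Fin m) → List (Fin (suc m))
  insertSwaps p ks = cycleTo p ++ map suc ks

  applySwaps-insertSwaps-zero : ∀ {m} p (ks : List (Fin m)) → applySwaps (insertSwaps p ks) zero ≡ p
  applySwaps-insertSwaps-zero p ks = trans (applySwaps-++ (cycleTo p) (map suc ks) zero)
    (trans (cong (applySwaps (cycleTo p)) (applySwaps-map-suc-zero ks)) (applySwaps-cycleTo-zero p))

  applySwaps-insertSwaps-suc : ∀ {m} p (ks : List (Fin m)) i →
    applySwaps (insertSwaps p ks) (suc i) ≡ punchIn p (applySwaps ks i)
  applySwaps-insertSwaps-suc p ks i = trans (applySwaps-++ (cycleTo p) (map suc ks) (suc i))
    (trans (cong (applySwaps (cycleTo p)) (applySwaps-map-suc ks i)) (applySwaps-cycleTo-suc p (applySwaps ks i)))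

  injective⇒applySwaps : ∀ m (π : Fin (suc m) → Fin (suc m)) → Injective _≡_ _≡_ π →
    Σ[ ks ∈ List (Fin m) ] (∀ i → π i ≡ applySwaps ks i)
  injective⇒applySwaps zero    π π-inj = [] , λ { zero → only (π zero) }
    where
    only : (x : Fin 1) → x ≡ zero
    only zero = refl
  injective⇒applySwaps (suc m) π π-inj = insertSwaps p ks , agree
    where
    p = π zero
    p≢ : ∀ i → p ≢ π (suc i)
    p≢ i e with π-inj e
    ... | ()
    π′ : Fin (suc m) → Fin (suc m)
    π′ i = punchOut (p≢ i)
    π′-inj : Injective _≡_ _≡_ π′
    π′-inj e = suc-injective (π-inj (trans (sym (punchIn-punchOut (p≢ _))) (trans (cong (punchIn p) e) (punchIn-punchOut (p≢ _)))))
    ks = proj₁ (injective⇒applySwaps m π′ π′-inj)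
    agree : ∀ i → π i ≡ applySwaps (insertSwaps p ks) i
    agree zero    = sym (applySwaps-insertSwaps-zero p ks)
    agree (suc i) = begin
      π (suc i)                            ≡⟨ sym (punchIn-punchOut (p≢ i)) ⟩
      punchIn p (π′ i)                     ≡⟨ cong (punchIn p) (proj₂ (injective⇒applySwaps m π′ π′-inj) i) ⟩
      punchIn p (applySwaps ks i)          ≡⟨ sym (applySwaps-insertSwaps-suc p ks i) ⟩
      applySwaps (insertSwaps p ks) (suc i) ∎
      where open ≡-Reasoning

  det-conj-injective : ∀ m (π : Fin m → Fin m) → Injective _≡_ _≡_ π →
    ∀ M → detℤ m (λ i j → M (π i) (π j)) ≡ detℤ m M
  det-conj-injective zero    π π-inj M = refl
  det-conj-injective (suc m) π π-inj M with injective⇒applySwaps m π π-inj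
  ... | ks , π≗ = trans (det-cong (suc m) (λ i j → cong₂ M (π≗ i) (π≗ j))) (det-conj-applySwaps m ks M)

  self-neg⇒zero : ∀ x → x ≡ - x → x ≡ 0ℤ
  self-neg⇒zero +0       _  = refl
  self-neg⇒zero +[1+ n ] ()
  self-neg⇒zero -[1+ n ] ()

  -- Conjugating by a permutation that sends 0, 1 to r, s makes the two equal lines adjacent;
  -- swapping them leaves the matrix unchanged but negates the determinant.
  module _ {m} (M : Matrix (suc (suc m))) {r s : Fin (suc (suc m))} (r≢s : r ≢ s) where

    private
      swaps : List (Fin (suc m))
      swaps = insertSwaps r (cycleTo (punchOut r≢s))

      π : Fin (suc (suc m)) → Fin (suc (suc m))
      π = applySwaps swaps

      π-zero : π zero ≡ r
      π-zero = applySwaps-insertSwaps-zero r _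

      π-one : π (suc zero) ≡ s
      π-one = trans (applySwaps-insertSwaps-suc r _ zero)
                    (trans (cong (punchIn r) (applySwaps-cycleTo-zero (punchOut r≢s))) (punchIn-punchOut r≢s))

      M′ : Matrix (suc (suc m))
      M′ i j = M (π i) (π j)

      det-M′ : detℤ (suc (suc m)) M′ ≡ detℤ (suc (suc m)) M
      det-M′ = det-conj-applySwaps (suc m) swaps M

    det-equal-rows : (∀ j → M r j ≡ M s j) → detℤ (suc (suc m)) M ≡ 0ℤ
    det-equal-rows r≗s = trans (sym det-M′)
      (self-neg⇒zero _ (trans (det-cong (suc (suc m)) rows) (det-swap-adjacent-rows (suc m) zero M′)))
      where
      rows : ∀ i j → M′ i j ≡ M′ (adjSwap zero i) j
      rows zero          j rewrite π-zero | π-one = r≗s (π j)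
      rows (suc zero)    j rewrite π-zero | π-one = sym (r≗s (π j))
      rows (suc (suc i)) j = refl

    det-equal-cols : (∀ i → M i r ≡ M i s) → detℤ (suc (suc m)) M ≡ 0ℤ
    det-equal-cols r≗s = trans (sym det-M′)
      (self-neg⇒zero _ (trans (det-cong (suc (suc m)) cols) (det-swap-adjacent-cols (suc m) zero M′)))
      where
      cols : ∀ i j → M′ i j ≡ M′ i (adjSwap zero j)
      cols i zero          rewrite π-zero | π-one = r≗s (π i)
      cols i (suc zero)    rewrite π-zero | π-one = sym (r≗s (π i))
      cols i (suc (suc j)) = refl

  det-add-row : ∀ m {r s : Fin m} → r ≢ s → {M M′ : Matrix m} →
    (∀ i → i ≢ r → M′ i ≗ M i) → (∀ j → M′ r j ≡ M r j + M s j) → detℤ m M′ ≡ detℤ m M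
  det-add-row (suc zero) {zero} {zero} r≢s _ _ = ⊥-elim (r≢s refl)
  det-add-row (suc (suc m)) {r} {s} r≢s {M} {M′} same sum-row = begin
    detℤ (suc (suc m)) M′
      ≡⟨ det-additive-row (suc (suc m)) r (λ i i≢r j → sym (same i i≢r j)) copy-same copy-row ⟩
    detℤ (suc (suc m)) M + detℤ (suc (suc m)) copy ≡⟨ cong (detℤ (suc (suc m)) M +_) (det-equal-rows copy r≢s copy-equal) ⟩
    detℤ (suc (suc m)) M + 0ℤ                      ≡⟨ ℤ.+-identityʳ _ ⟩
    detℤ (suc (suc m)) M                           ∎
    where
    open ≡-Reasoning
    copy : Matrix (suc (suc m))
    copy i with i ≟ r
    ... | yes _ = M s
    ... | no _  = M i
    copy-same : ∀ i → i ≢ r → copy i ≗ M′ i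
    copy-same i i≢r j with i ≟ r
    ... | yes i≡r = ⊥-elim (i≢r i≡r)
    ... | no _    = sym (same i i≢r j)
    copy-at-r : copy r ≗ M s
    copy-at-r j with r ≟ r
    ... | yes _  = refl
    ... | no r≢r = ⊥-elim (r≢r refl)
    copy-at-s : copy s ≗ M s
    copy-at-s j with s ≟ r
    ... | yes _ = refl
    ... | no _  = refl
    copy-row : ∀ j → M′ r j ≡ M r j + copy r j
    copy-row j = trans (sum-row j) (cong (M r j +_) (sym (copy-at-r j)))
    copy-equal : ∀ j → copy r j ≡ copy s j
    copy-equal j = trans (copy-at-r j) (sym (copy-at-s j))

  det-add-col : ∀ m {r s : Fin m} → r ≢ s → {M M′ : Matrix m} →
    (∀ i j → j ≢ r → M′ i j ≡ M i j) → (∀ i → M′ i r ≡ M i r + M i s) → detℤ m M′ ≡ detℤ m M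
  det-add-col (suc zero) {zero} {zero} r≢s _ _ = ⊥-elim (r≢s refl)
  det-add-col (suc (suc m)) {r} {s} r≢s {M} {M′} same sum-col = begin
    detℤ (suc (suc m)) M′
      ≡⟨ det-additive-col (suc (suc m)) r (λ i j j≢r → sym (same i j j≢r)) copy-same copy-col ⟩
    detℤ (suc (suc m)) M + detℤ (suc (suc m)) copy ≡⟨ cong (detℤ (suc (suc m)) M +_) (det-equal-cols copy r≢s copy-equal) ⟩
    detℤ (suc (suc m)) M + 0ℤ                      ≡⟨ ℤ.+-identityʳ _ ⟩
    detℤ (suc (suc m)) M                           ∎
    where
    open ≡-Reasoning
    copy : Matrix (suc (suc m))
    copy i j with j ≟ r
    ... | yes _ = M i s
    ... | no _  = M i j
    copy-same : ∀ i j → j ≢ r → copy i j ≡ M′ i j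
    copy-same i j j≢r with j ≟ r
    ... | yes j≡r = ⊥-elim (j≢r j≡r)
    ... | no _    = sym (same i j j≢r)
    copy-at-r : ∀ i → copy i r ≡ M i s
    copy-at-r i with r ≟ r
    ... | yes _  = refl
    ... | no r≢r = ⊥-elim (r≢r refl)
    copy-at-s : ∀ i → copy i s ≡ M i s
    copy-at-s i with s ≟ r
    ... | yes _ = refl
    ... | no _  = refl
    copy-col : ∀ i → M′ i r ≡ M i r + copy i r
    copy-col i = trans (sum-col i) (cong (M i r +_) (sym (copy-at-r i)))
    copy-equal : ∀ i → copy i r ≡ copy i s
    copy-equal i = trans (copy-at-r i) (sym (copy-at-s i))

  det-neg : ∀ m (M : Matrix m) → detℤ m (λ i j → - M i j) ≡ signℤ m * detℤ m M
  det-neg zero    M = refl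
  det-neg (suc m) M = trans (sum-cong-≗ term) (sym (*-distribˡ-sum (signℤ (suc m)) (laplaceTerm M)))
    where
    term : ∀ j → laplaceTerm (λ i k → - M i k) j ≡ signℤ (suc m) * laplaceTerm M j
    term j rewrite det-neg m (minor M j) =
      solve 4 (λ s a t d → s :* (:- a :* (t :* d)) := :- t :* (s :* (a :* d))) refl (sign j) (M zero j) (signℤ m) _

  blockLower : ∀ a b → Matrix a → (Fin b → Fin a → ℤ) → Matrix b → Matrix (a ℕ.+ b)
  blockLower a b X Y Z i j = entry (splitAt a i) (splitAt a j)
    where
    entry : Fin a ⊎ Fin b → Fin a ⊎ Fin b → ℤ
    entry (inj₁ i) (inj₁ j) = X i j
    entry (inj₁ i) (inj₂ j) = 0ℤ
    entry (inj₂ i) (inj₁ j) = Y i j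
    entry (inj₂ i) (inj₂ j) = Z i j

  splitAt-punchIn-↑ˡ : ∀ a b (j : Fin (suc a)) (l : Fin (a ℕ.+ b)) →
    splitAt (suc a) (punchIn (j ↑ˡ b) l) ≡ Sum.map (punchIn j) id (splitAt a l)
  splitAt-punchIn-↑ˡ a       b zero    l       = refl
  splitAt-punchIn-↑ˡ (suc a) b (suc j) zero    = refl
  splitAt-punchIn-↑ˡ (suc a) b (suc j) (suc l) rewrite splitAt-punchIn-↑ˡ a b j l with splitAt a l
  ... | inj₁ _ = refl
  ... | inj₂ _ = refl

  minor-blockLower : ∀ a b X Y Z (j : Fin (suc a)) i l →
    minor (blockLower (suc a) b X Y Z) (j ↑ˡ b) i l ≡ blockLower a b (minor X j) (λ i l → Y i (punchIn j l)) Z i l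
  minor-blockLower a b X Y Z j i l rewrite splitAt-punchIn-↑ˡ a b j l with splitAt a i | splitAt a l
  ... | inj₁ _ | inj₁ _ = refl
  ... | inj₁ _ | inj₂ _ = refl
  ... | inj₂ _ | inj₁ _ = refl
  ... | inj₂ _ | inj₂ _ = refl

  det-blockLower : ∀ a b X Y Z → detℤ (a ℕ.+ b) (blockLower a b X Y Z) ≡ detℤ a X * detℤ b Z
  det-blockLower zero    b X Y Z = sym (ℤ.*-identityˡ _)
  det-blockLower (suc a) b X Y Z = begin
    sum (laplaceTerm M)
      ≡⟨ sum-splitAt (suc a) (laplaceTerm M) ⟩
    sum (λ j → laplaceTerm M (j ↑ˡ b)) + sum (λ j → laplaceTerm M (suc a ↑ʳ j))
      ≡⟨ cong₂ _+_ (sum-cong-≗ left) (sum-zero (λ j → laplaceTerm M (suc a ↑ʳ j)) right) ⟩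
    sum (λ j → detℤ b Z * laplaceTerm X j) + 0ℤ
      ≡⟨ ℤ.+-identityʳ _ ⟩
    sum (λ j → detℤ b Z * laplaceTerm X j)
      ≡⟨ sym (*-distribˡ-sum (detℤ b Z) (laplaceTerm X)) ⟩
    detℤ b Z * detℤ (suc a) X
      ≡⟨ ℤ.*-comm (detℤ b Z) (detℤ (suc a) X) ⟩
    detℤ (suc a) X * detℤ b Z ∎
    where
    open ≡-Reasoning
    M = blockLower (suc a) b X Y Z
    right : ∀ j → laplaceTerm M (suc a ↑ʳ j) ≡ 0ℤ
    right j rewrite splitAt-↑ʳ (suc a) b j = ℤ.*-zeroʳ (sign (suc a ↑ʳ j))
    left : ∀ j → laplaceTerm M (j ↑ˡ b) ≡ detℤ b Z * laplaceTerm X j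
    left j rewrite splitAt-↑ˡ (suc a) j b | det-cong (a ℕ.+ b) (minor-blockLower a b X Y Z j)
                 | det-blockLower a b (minor X j) (λ i l → Y i (punchIn j l)) Z | toℕ-↑ˡ j b =
      solve 4 (λ s x d z → s :* (x :* (d :* z)) := z :* (s :* (x :* d))) refl (sign j) (X zero j) (detℤ a (minor X j)) (detℤ b Z)

module Bipartite where

  open import Data.Nat as ℕ using (ℕ; zero; suc; _<_; _≤_; _<?_)
  import Data.Nat.Properties as ℕ
  open import Data.Integer using (ℤ; -_; _+_; _*_; 0ℤ)
  import Data.Integer.Properties as ℤ
  open import Data.Integer.Solver using (module +-*-Solver)
  open import Data.Bool using (if_then_else_)
  open import Data.Fin using (Fin; toℕ; fromℕ<; _↑ˡ_; _↑ʳ_; splitAt; join; _≟_)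
  open import Data.Fin.Properties using (splitAt-↑ˡ; splitAt-↑ʳ; splitAt⁻¹-↑ˡ; join-splitAt; splitAt-join;
    toℕ-fromℕ<; toℕ-injective; toℕ<n; ↑ˡ-injective; ↑ʳ-injective)
  open import Data.Sum as Sum using (_⊎_; inj₁; inj₂)
  open import Data.Sum.Properties using (swap-involutive)
  open import Function using (_∘_; id)
  open import Function.Definitions using (Injective)
  open import Relation.Binary.PropositionalEquality
  open import Relation.Nullary using (yes; no)
  open import Relation.Nullary.Decidable using (⌊_⌋)
  open import Data.Empty using (⊥-elim)
  open +-*-Solver using (solve; _:+_; :-_; _:=_; con)
  open Determinant

  ↑ˡ≢↑ʳ : ∀ {a b} (i : Fin a) (j : Fin b) → i ↑ˡ b ≢ a ↑ʳ j
  ↑ˡ≢↑ʳ {a} {b} i j e with trans (sym (splitAt-↑ˡ a i b)) (trans (cong (splitAt a) e) (splitAt-↑ʳ a b j))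
  ... | ()

  blockwise : ∀ {a b} (P : Fin (a ℕ.+ b) → Fin (a ℕ.+ b) → Set) →
    (∀ i i′ → P (i ↑ˡ b) (i′ ↑ˡ b)) → (∀ i j → P (i ↑ˡ b) (a ↑ʳ j)) →
    (∀ j i → P (a ↑ʳ j) (i ↑ˡ b)) → (∀ j j′ → P (a ↑ʳ j) (a ↑ʳ j′)) → ∀ i j → P i j
  blockwise {a} {b} P p₁₁ p₁₂ p₂₁ p₂₂ i j =
    subst₂ P (join-splitAt a b i) (join-splitAt a b j) (joined (splitAt a i) (splitAt a j))
    where
    joined : ∀ x y → P (join a b x) (join a b y)
    joined (inj₁ i) (inj₁ i′) = p₁₁ i i′
    joined (inj₁ i) (inj₂ j)  = p₁₂ i j
    joined (inj₂ j) (inj₁ i)  = p₂₁ j i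
    joined (inj₂ j) (inj₂ j′) = p₂₂ j j′

  transpose : ∀ {m} → Matrix m → Matrix m
  transpose M i j = M j i

  module Sweeps (N : ℕ) where

    -- The threshold k makes each induction step a single row addition; k = N is the full block operation.
    addLowerRows : ℕ → Matrix (N ℕ.+ N) → Matrix (N ℕ.+ N)
    addLowerRows k M i j with splitAt N i
    ... | inj₂ _ = M i j
    ... | inj₁ e with toℕ e <? k
    ...   | yes _ = M i j + M (N ↑ʳ e) j
    ...   | no _  = M i j

    addLowerRows-zero : ∀ M i j → addLowerRows 0 M i j ≡ M i j
    addLowerRows-zero M i j with splitAt N i
    ... | inj₂ _ = refl
    ... | inj₁ e with toℕ e <? 0
    ...   | no _ = refl

    addLowerRows-saturated : ∀ k → N ≤ k → ∀ M i j → addLowerRows (suc k) M i j ≡ addLowerRows k M i j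
    addLowerRows-saturated k N≤k M i j with splitAt N i
    ... | inj₂ _ = refl
    ... | inj₁ e with toℕ e <? suc k | toℕ e <? k
    ...   | yes _ | yes _ = refl
    ...   | no _  | no _  = refl
    ...   | no e≮1+k | yes e<k = ⊥-elim (e≮1+k (ℕ.m<n⇒m<1+n e<k))
    ...   | yes _ | no e≮k = ⊥-elim (e≮k (ℕ.<-≤-trans (toℕ<n e) N≤k))

    module Step (k : ℕ) (k<N : k < N) where

      row : Fin N
      row = fromℕ< k<N

      addLowerRows-elsewhere : ∀ M i → i ≢ row ↑ˡ N → ∀ j → addLowerRows (suc k) M i j ≡ addLowerRows k M i j
      addLowerRows-elsewhere M i i≢row j with splitAt N i in split
      ... | inj₂ _ = refl
      ... | inj₁ e with toℕ e <? suc k | toℕ e <? k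
      ...   | yes _ | yes _ = refl
      ...   | no _  | no _  = refl
      ...   | no e≮1+k | yes e<k = ⊥-elim (e≮1+k (ℕ.m<n⇒m<1+n e<k))
      ...   | yes e<1+k | no e≮k = ⊥-elim (i≢row (trans (sym (splitAt⁻¹-↑ˡ split)) (cong (_↑ˡ N) e≡row)))
        where
        e≡row : e ≡ row
        e≡row = toℕ-injective (trans (ℕ.≤-antisym (ℕ.s≤s⁻¹ e<1+k) (ℕ.≮⇒≥ e≮k)) (sym (toℕ-fromℕ< k<N)))

      addLowerRows-at : ∀ M j → addLowerRows (suc k) M (row ↑ˡ N) j
                                ≡ addLowerRows k M (row ↑ˡ N) j + addLowerRows k M (N ↑ʳ row) j
      addLowerRows-at M j rewrite splitAt-↑ˡ N row N | splitAt-↑ʳ N N row with toℕ row <? suc k | toℕ row <? k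
      ... | yes _ | no _ = refl
      ... | no row≮1+k | _ = ⊥-elim (row≮1+k (subst (_< suc k) (sym (toℕ-fromℕ< k<N)) (ℕ.n<1+n k)))
      ... | _ | yes row<k = ⊥-elim (ℕ.<-irrefl (toℕ-fromℕ< k<N) row<k)

    det-addLowerRows : ∀ k M → detℤ (N ℕ.+ N) (addLowerRows k M) ≡ detℤ (N ℕ.+ N) M
    det-addLowerRows zero    M = det-cong (N ℕ.+ N) (addLowerRows-zero M)
    det-addLowerRows (suc k) M with k <? N
    ... | yes k<N = trans (det-add-row (N ℕ.+ N) (↑ˡ≢↑ʳ row row) (addLowerRows-elsewhere M) (addLowerRows-at M))
                          (det-addLowerRows k M)
      where open Step k k<N
    ... | no k≮N = trans (det-cong (N ℕ.+ N) (addLowerRows-saturated k (ℕ.≮⇒≥ k≮N) M)) (det-addLowerRows k M)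

    det-addLowerRows-transposed : ∀ k M → detℤ (N ℕ.+ N) (transpose (addLowerRows k (transpose M))) ≡ detℤ (N ℕ.+ N) M
    det-addLowerRows-transposed zero    M = det-cong (N ℕ.+ N) (λ i j → addLowerRows-zero (transpose M) j i)
    det-addLowerRows-transposed (suc k) M with k <? N
    ... | yes k<N = trans (det-add-col (N ℕ.+ N) (↑ˡ≢↑ʳ row row)
                             (λ i j j≢row → addLowerRows-elsewhere (transpose M) j j≢row i) (addLowerRows-at (transpose M)))
                          (det-addLowerRows-transposed k M)
      where open Step k k<N
    ... | no k≮N = trans (det-cong (N ℕ.+ N) (λ i j → addLowerRows-saturated k (ℕ.≮⇒≥ k≮N) (transpose M) j i))
                         (det-addLowerRows-transposed k M)

    addLowerRows-upper : ∀ M e j → addLowerRows N M (e ↑ˡ N) j ≡ M (e ↑ˡ N) j + M (N ↑ʳ e) j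
    addLowerRows-upper M e j rewrite splitAt-↑ˡ N e N with toℕ e <? N
    ... | yes _   = refl
    ... | no e≮N = ⊥-elim (e≮N (toℕ<n e))

    addLowerRows-lower : ∀ M o j → addLowerRows N M (N ↑ʳ o) j ≡ M (N ↑ʳ o) j
    addLowerRows-lower M o j rewrite splitAt-↑ʳ N N o = refl

    flipHalves : Fin (N ℕ.+ N) → Fin (N ℕ.+ N)
    flipHalves i = join N N (Sum.swap (splitAt N i))

    flipHalves-↑ˡ : ∀ e → flipHalves (e ↑ˡ N) ≡ N ↑ʳ e
    flipHalves-↑ˡ e rewrite splitAt-↑ˡ N e N = refl

    flipHalves-↑ʳ : ∀ o → flipHalves (N ↑ʳ o) ≡ o ↑ˡ N
    flipHalves-↑ʳ o rewrite splitAt-↑ʳ N N o = refl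

    flipHalves-involutive : ∀ i → flipHalves (flipHalves i) ≡ i
    flipHalves-involutive i = trans (cong (join N N ∘ Sum.swap) (splitAt-join N N (Sum.swap (splitAt N i))))
                                    (trans (cong (join N N) (swap-involutive (splitAt N i))) (join-splitAt N N i))

    flipHalves-injective : Injective _≡_ _≡_ flipHalves
    flipHalves-injective {x} {y} e = trans (sym (flipHalves-involutive x)) (trans (cong flipHalves e) (flipHalves-involutive y))

    addUpperRows : ℕ → Matrix (N ℕ.+ N) → Matrix (N ℕ.+ N)
    addUpperRows k M i j = addLowerRows k (λ i′ j′ → M (flipHalves i′) (flipHalves j′)) (flipHalves i) (flipHalves j)

    addUpperRows-upper : ∀ M e j → addUpperRows N M (e ↑ˡ N) j ≡ M (e ↑ˡ N) j
    addUpperRows-upper M e j rewrite flipHalves-↑ˡ e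
      | addLowerRows-lower (λ i′ j′ → M (flipHalves i′) (flipHalves j′)) e (flipHalves j)
      | flipHalves-↑ʳ e | flipHalves-involutive j = refl

    addUpperRows-lower : ∀ M o j → addUpperRows N M (N ↑ʳ o) j ≡ M (N ↑ʳ o) j + M (o ↑ˡ N) j
    addUpperRows-lower M o j rewrite flipHalves-↑ʳ o
      | addLowerRows-upper (λ i′ j′ → M (flipHalves i′) (flipHalves j′)) o (flipHalves j)
      | flipHalves-↑ˡ o | flipHalves-↑ʳ o | flipHalves-involutive j = refl

    addLeftCols : Matrix (N ℕ.+ N) → Matrix (N ℕ.+ N)
    addLeftCols M = transpose (addUpperRows N (transpose M))

    addLeftCols-left : ∀ M i e → addLeftCols M i (e ↑ˡ N) ≡ M i (e ↑ˡ N)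
    addLeftCols-left M i e = addUpperRows-upper (transpose M) e i

    addLeftCols-right : ∀ M i o → addLeftCols M i (N ↑ʳ o) ≡ M i (N ↑ʳ o) + M i (o ↑ˡ N)
    addLeftCols-right M i o = addUpperRows-lower (transpose M) o i

    det-addLeftCols : ∀ M → detℤ (N ℕ.+ N) (addLeftCols M) ≡ detℤ (N ℕ.+ N) M
    det-addLeftCols M = begin
      detℤ (N ℕ.+ N) (addLeftCols M)      ≡⟨ det-conj-injective (N ℕ.+ N) flipHalves flipHalves-injective swept ⟩
      detℤ (N ℕ.+ N) swept                ≡⟨ det-addLowerRows-transposed N M′ ⟩
      detℤ (N ℕ.+ N) M′                   ≡⟨ det-conj-injective (N ℕ.+ N) flipHalves flipHalves-injective M ⟩
      detℤ (N ℕ.+ N) M                    ∎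
      where
      open ≡-Reasoning
      M′ : Matrix (N ℕ.+ N)
      M′ i j = M (flipHalves i) (flipHalves j)
      swept : Matrix (N ℕ.+ N)
      swept = transpose (addLowerRows N (transpose M′))

  scalar : ∀ {m} → ℤ → Matrix m
  scalar t i j = if ⌊ i ≟ j ⌋ then t else 0ℤ

  scalar-conj-injective : ∀ {m n} (f : Fin m → Fin n) → Injective _≡_ _≡_ f →
    ∀ t x y → scalar t (f x) (f y) ≡ scalar t x y
  scalar-conj-injective f f-inj t x y with f x ≟ f y | x ≟ y
  ... | yes _   | yes _   = refl
  ... | no _    | no _    = refl
  ... | yes fx≡fy | no x≢y = ⊥-elim (x≢y (f-inj fx≡fy))
  ... | no fx≢fy | yes refl = ⊥-elim (fx≢fy refl)

  scalar-↑ˡ : ∀ {a} b t (i i′ : Fin a) → scalar t (i ↑ˡ b) (i′ ↑ˡ b) ≡ scalar t i i′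
  scalar-↑ˡ b = scalar-conj-injective (_↑ˡ b) (↑ˡ-injective b _ _)

  scalar-↑ʳ : ∀ a {b} t (j j′ : Fin b) → scalar t (a ↑ʳ j) (a ↑ʳ j′) ≡ scalar t j j′
  scalar-↑ʳ a = scalar-conj-injective (a ↑ʳ_) (↑ʳ-injective a _ _)

  scalar-off-diagonal : ∀ {m} t {x y : Fin m} → x ≢ y → scalar t x y ≡ 0ℤ
  scalar-off-diagonal t {x} {y} x≢y with x ≟ y
  ... | yes x≡y = ⊥-elim (x≢y x≡y)
  ... | no _    = refl

  charMatrix : ∀ {m} → ℤ → Matrix m → Matrix m
  charMatrix t M i j = scalar t i j + - M i j

  bipartite : ∀ {N} → Matrix N → Matrix (N ℕ.+ N)
  bipartite {N} B i j = entry (splitAt N i) (splitAt N j)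
    where
    entry : Fin N ⊎ Fin N → Fin N ⊎ Fin N → ℤ
    entry (inj₁ e) (inj₂ o) = B e o
    entry (inj₂ o) (inj₁ e) = B e o
    entry (inj₁ _) (inj₁ _) = 0ℤ
    entry (inj₂ _) (inj₂ _) = 0ℤ

  module _ {N} (A B : Matrix N) (τ : Fin N → Fin N) (τ-inj : Injective _≡_ _≡_ τ)
           (B∘τ≡A : ∀ e o → B e (τ o) ≡ A e o) (t : ℤ) where

    private
      relabel : Fin (N ℕ.+ N) → Fin (N ℕ.+ N)
      relabel i = join N N (Sum.map id τ (splitAt N i))

      relabel-inj : Injective _≡_ _≡_ relabel
      relabel-inj {x} {y} e = trans (sym (join-splitAt N N x))
        (trans (cong (join N N) (map-inj (splitAt N x) (splitAt N y) split≡)) (join-splitAt N N y))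
        where
        split≡ : Sum.map id τ (splitAt N x) ≡ Sum.map id τ (splitAt N y)
        split≡ = trans (sym (splitAt-join N N _)) (trans (cong (splitAt N) e) (splitAt-join N N _))
        map-inj : ∀ a b → Sum.map id τ a ≡ Sum.map id τ b → a ≡ b
        map-inj (inj₁ a) (inj₁ b) refl = refl
        map-inj (inj₂ a) (inj₂ b) e = cong inj₂ (τ-inj (cong Sum.[ (λ _ → τ a) , id ] e))
        map-inj (inj₁ _) (inj₂ _) ()
        map-inj (inj₂ _) (inj₁ _) ()

      splitAt-relabel : ∀ i → splitAt N (relabel i) ≡ Sum.map id τ (splitAt N i)
      splitAt-relabel i = splitAt-join N N _

      bipartite-relabel : ∀ i j → bipartite B (relabel i) (relabel j) ≡ bipartite A i j
      bipartite-relabel i j rewrite splitAt-relabel i | splitAt-relabel j with splitAt N i | splitAt N j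
      ... | inj₁ e | inj₁ _ = refl
      ... | inj₁ e | inj₂ o = B∘τ≡A e o
      ... | inj₂ o | inj₁ e = B∘τ≡A e o
      ... | inj₂ _ | inj₂ _ = refl

    det-charMatrix-bipartite-relabel :
      detℤ (N ℕ.+ N) (charMatrix t (bipartite B)) ≡ detℤ (N ℕ.+ N) (charMatrix t (bipartite A))
    det-charMatrix-bipartite-relabel = begin
      detℤ (N ℕ.+ N) (charMatrix t (bipartite B))
        ≡⟨ sym (det-conj-injective (N ℕ.+ N) relabel relabel-inj (charMatrix t (bipartite B))) ⟩
      detℤ (N ℕ.+ N) (λ i j → charMatrix t (bipartite B) (relabel i) (relabel j))
        ≡⟨ det-cong (N ℕ.+ N) (λ i j → cong₂ (λ x y → x + - y) (scalar-conj-injective relabel relabel-inj t i j)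
                                                              (bipartite-relabel i j)) ⟩
      detℤ (N ℕ.+ N) (charMatrix t (bipartite A)) ∎
      where open ≡-Reasoning

  module _ {N} (A : Matrix N) (A-sym : ∀ i j → A i j ≡ A j i) (t : ℤ) where

    open Sweeps N

    private
      K : Matrix (N ℕ.+ N)
      K = charMatrix t (bipartite A)

      lower : Matrix (N ℕ.+ N)
      lower = blockLower N N (charMatrix t A) (λ o e → - A e o) (λ i j → scalar t i j + A i j)

      -- The column operation is applied to the block triangular target rather than subtracted from K.
      swept : ∀ i j → addLeftCols lower i j ≡ addLowerRows N K i j
      swept = blockwise _ upper-left upper-right lower-left lower-right
        where
        upper-left : ∀ e e′ → addLeftCols lower (e ↑ˡ N) (e′ ↑ˡ N) ≡ addLowerRows N K (e ↑ˡ N) (e′ ↑ˡ N)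
        upper-left e e′
          rewrite addLeftCols-left lower (e ↑ˡ N) e′ | addLowerRows-upper K e (e′ ↑ˡ N)
                | splitAt-↑ˡ N e N | splitAt-↑ˡ N e′ N | splitAt-↑ʳ N N e
                | scalar-↑ˡ N t e e′ | scalar-off-diagonal t (↑ˡ≢↑ʳ e′ e ∘ sym) | A-sym e′ e =
          solve 2 (λ s a → s :+ :- a := (s :+ :- con 0ℤ) :+ (con 0ℤ :+ :- a)) refl (scalar t e e′) (A e e′)
        upper-right : ∀ e o → addLeftCols lower (e ↑ˡ N) (N ↑ʳ o) ≡ addLowerRows N K (e ↑ˡ N) (N ↑ʳ o)
        upper-right e o
          rewrite addLeftCols-right lower (e ↑ˡ N) o | addLowerRows-upper K e (N ↑ʳ o)
                | splitAt-↑ˡ N e N | splitAt-↑ˡ N o N | splitAt-↑ʳ N N e | splitAt-↑ʳ N N o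
                | scalar-off-diagonal t (↑ˡ≢↑ʳ e o) | scalar-↑ʳ N t e o =
          solve 2 (λ s a → con 0ℤ :+ (s :+ :- a) := (con 0ℤ :+ :- a) :+ (s :+ :- con 0ℤ)) refl (scalar t e o) (A e o)
        lower-left : ∀ o e → addLeftCols lower (N ↑ʳ o) (e ↑ˡ N) ≡ addLowerRows N K (N ↑ʳ o) (e ↑ˡ N)
        lower-left o e
          rewrite addLeftCols-left lower (N ↑ʳ o) e | addLowerRows-lower K o (e ↑ˡ N)
                | splitAt-↑ˡ N e N | splitAt-↑ʳ N N o
                | scalar-off-diagonal t (↑ˡ≢↑ʳ e o ∘ sym) = sym (ℤ.+-identityˡ _)
        lower-right : ∀ o o′ → addLeftCols lower (N ↑ʳ o) (N ↑ʳ o′) ≡ addLowerRows N K (N ↑ʳ o) (N ↑ʳ o′)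
        lower-right o o′
          rewrite addLeftCols-right lower (N ↑ʳ o) o′ | addLowerRows-lower K o (N ↑ʳ o′)
                | splitAt-↑ʳ N N o | splitAt-↑ʳ N N o′ | splitAt-↑ˡ N o′ N
                | scalar-↑ʳ N t o o′ | A-sym o′ o =
          solve 2 (λ s a → (s :+ a) :+ :- a := s :+ :- con 0ℤ) refl (scalar t o o′) (A o o′)

    det-charMatrix-bipartite : detℤ (N ℕ.+ N) (charMatrix t (bipartite A))
                               ≡ detℤ N (charMatrix t A) * detℤ N (λ i j → scalar t i j + A i j)
    det-charMatrix-bipartite = begin
      detℤ (N ℕ.+ N) K                    ≡⟨ sym (det-addLowerRows N K) ⟩
      detℤ (N ℕ.+ N) (addLowerRows N K)   ≡⟨ sym (det-cong (N ℕ.+ N) swept) ⟩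
      detℤ (N ℕ.+ N) (addLeftCols lower)  ≡⟨ det-addLeftCols lower ⟩
      detℤ (N ℕ.+ N) lower                ≡⟨ det-blockLower N N _ _ _ ⟩
      detℤ N (charMatrix t A) * detℤ N (λ i j → scalar t i j + A i j) ∎
      where open ≡-Reasoning

module Evaluation where

  open import Data.Nat as ℕ using (ℕ; zero; suc; _≤_; s≤s)
  import Data.Nat.Properties as ℕ
  open import Data.Integer using (ℤ; +_; -_; _+_; _*_; _-_; 0ℤ; 1ℤ)
  import Data.Integer.Properties as ℤ
  open import Data.Integer.Solver using (module +-*-Solver)
  open import Data.List using ([]; _∷_; length)
  open import Data.Fin using (zero; suc; punchIn)
  open import Data.Sum using (inj₂)
  open import Relation.Binary.PropositionalEquality
  open import Function using (_∘_)
  open +-*-Solver using (solve; _:+_; _:*_; :-_; _:=_; con)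
  open Determinant using (detℤ; laplaceTerm; sign)
  open import Algebra.Properties.Semiring.Sum ℤ.+-*-semiring using (sum; sum-cong-≗)

  eval : Poly → ℤ → ℤ
  eval []      t = 0ℤ
  eval (a ∷ p) t = a + t * eval p t

  eval-+P : ∀ p q t → eval (p +P q) t ≡ eval p t + eval q t
  eval-+P []      q       t = sym (ℤ.+-identityˡ _)
  eval-+P (a ∷ p) []      t = sym (ℤ.+-identityʳ _)
  eval-+P (a ∷ p) (b ∷ q) t rewrite eval-+P p q t =
    solve 5 (λ a b t x y → (a :+ b) :+ t :* (x :+ y) := (a :+ t :* x) :+ (b :+ t :* y)) refl a b t (eval p t) (eval q t)

  eval-scaleP : ∀ c p t → eval (scaleP c p) t ≡ c * eval p t
  eval-scaleP c []      t = sym (ℤ.*-zeroʳ c)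
  eval-scaleP c (a ∷ p) t rewrite eval-scaleP c p t =
    solve 4 (λ c a t x → c :* a :+ t :* (c :* x) := c :* (a :+ t :* x)) refl c a t (eval p t)

  eval-negP : ∀ p t → eval (negP p) t ≡ - eval p t
  eval-negP []      t = refl
  eval-negP (a ∷ p) t rewrite eval-negP p t =
    solve 3 (λ a t x → :- a :+ t :* :- x := :- (a :+ t :* x)) refl a t (eval p t)

  eval-*P : ∀ p q t → eval (p *P q) t ≡ eval p t * eval q t
  eval-*P []      q t = sym (ℤ.*-zeroˡ (eval q t))
  eval-*P (a ∷ p) q t rewrite eval-+P (scaleP a q) (0ℤ ∷ (p *P q)) t | eval-scaleP a q t | eval-*P p q t =
    solve 4 (λ a t x y → a :* y :+ (con 0ℤ :+ t :* (x :* y)) := (a :+ t :* x) :* y) refl a t (eval p t) (eval q t)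

  eval-constP : ∀ c t → eval (constP c) t ≡ c
  eval-constP c t = solve 2 (λ c t → c :+ t :* con 0ℤ := c) refl c t

  eval-xP : ∀ t → eval xP t ≡ t
  eval-xP t = solve 1 (λ t → con 0ℤ :+ t :* (con 1ℤ :+ t :* con 0ℤ) := t) refl t

  eval-negArg : ∀ p t → eval (negArg p) t ≡ eval p (- t)
  eval-negArg []      t = refl
  eval-negArg (a ∷ p) t rewrite eval-negP (negArg p) t | eval-negArg p t =
    solve 3 (λ a t x → a :+ t :* :- x := a :+ :- t :* x) refl a t (eval p (- t))

  eval-sumP : ∀ m f t → eval (sumP m f) t ≡ sum (λ j → eval (f j) t)
  eval-sumP zero    f t = refl
  eval-sumP (suc m) f t rewrite eval-+P (f zero) (sumP m (λ j → f (suc j))) t | eval-sumP m (λ j → f (suc j)) t = refl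

  eval-det : ∀ m M t → eval (det m M) t ≡ detℤ m (λ i j → eval (M i j) t)
  eval-det zero    M t = eval-constP 1ℤ t
  eval-det (suc m) M t = trans (eval-sumP (suc m) (λ j → scaleP (sign j) (M zero j *P det m (λ i k → M (suc i) (punchIn j k)))) t)
                               (sum-cong-≗ term)
    where
    term : ∀ j → eval (scaleP (sign j) (M zero j *P det m (λ i k → M (suc i) (punchIn j k)))) t
               ≡ laplaceTerm (λ i k → eval (M i k) t) j
    term j rewrite eval-scaleP (sign j) (M zero j *P det m (λ i k → M (suc i) (punchIn j k))) t
                 | eval-*P (M zero j) (det m (λ i k → M (suc i) (punchIn j k))) t
                 | eval-det m (λ i k → M (suc i) (punchIn j k)) t = refl

  divByLinear : ℤ → Poly → Poly
  divByLinear c []          = []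
  divByLinear c (a ∷ [])    = []
  divByLinear c (a ∷ b ∷ p) = eval (b ∷ p) c ∷ divByLinear c (b ∷ p)

  length-divByLinear : ∀ c a p → length (divByLinear c (a ∷ p)) ≡ length p
  length-divByLinear c a []      = refl
  length-divByLinear c a (b ∷ p) = cong suc (length-divByLinear c b p)

  eval-divByLinear : ∀ c p t → eval p t ≡ (t - c) * eval (divByLinear c p) t + eval p c
  eval-divByLinear c []          t = solve 2 (λ t c → con 0ℤ := (t :+ :- c) :* con 0ℤ :+ con 0ℤ) refl t c
  eval-divByLinear c (a ∷ [])    t =
    solve 3 (λ a t c → a :+ t :* con 0ℤ := (t :+ :- c) :* con 0ℤ :+ (a :+ c :* con 0ℤ)) refl a t c
  eval-divByLinear c (a ∷ b ∷ p) t rewrite eval-divByLinear c (b ∷ p) t =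
    solve 5 (λ a t c q r → a :+ t :* ((t :+ :- c) :* q :+ r) := (t :+ :- c) :* (r :+ t :* q) :+ (a :+ c :* r))
      refl a t c (eval (divByLinear c (b ∷ p)) t) (eval (b ∷ p) c)

  coeff-zero-from-quotient : ∀ p c → eval p c ≡ 0ℤ → (∀ k → coeff (divByLinear c p) k ≡ 0ℤ) →
    ∀ k → coeff p k ≡ 0ℤ
  coeff-zero-from-quotient []          c _    _  k       = refl
  coeff-zero-from-quotient (a ∷ [])    c root _  zero    = trans (sym (eval-constP a c)) root
  coeff-zero-from-quotient (a ∷ [])    c _    _  (suc k) = refl
  coeff-zero-from-quotient (a ∷ b ∷ p) c root q≈0 zero  =
    trans (sym (trans (cong (λ z → a + c * z) (q≈0 zero)) (eval-constP a c))) root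
  coeff-zero-from-quotient (a ∷ b ∷ p) c _    q≈0 (suc k) = coeff-zero-from-quotient (b ∷ p) c (q≈0 zero) (q≈0 ∘ suc) k

  -- The quotient by x − c of a polynomial vanishing at c, c + 1, c + 2, … vanishes at c + 1, c + 2, …
  coeff-zero-from-roots : ∀ n p → length p ≤ n → ∀ c → (∀ (t : ℕ) → eval p (c + + t) ≡ 0ℤ) →
    ∀ k → coeff p k ≡ 0ℤ
  coeff-zero-from-roots n       []      _         c _     k = refl
  coeff-zero-from-roots (suc n) (a ∷ p) (s≤s len) c roots =
    coeff-zero-from-quotient (a ∷ p) c root-c
      (coeff-zero-from-roots n (divByLinear c (a ∷ p)) (subst (_≤ n) (sym (length-divByLinear c a p)) len) (c + 1ℤ) quotient-roots)
    where
    root-c : eval (a ∷ p) c ≡ 0ℤ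
    root-c = trans (cong (eval (a ∷ p)) (sym (ℤ.+-identityʳ c))) (roots 0)
    quotient-roots : ∀ t → eval (divByLinear c (a ∷ p)) (c + 1ℤ + + t) ≡ 0ℤ
    quotient-roots t with ℤ.i*j≡0⇒i≡0∨j≡0 (+ suc t) product≡0
      where
      u = c + 1ℤ + + t
      product≡0 : + suc t * eval (divByLinear c (a ∷ p)) u ≡ 0ℤ
      product≡0 = begin
        + suc t * eval (divByLinear c (a ∷ p)) u
          ≡⟨ cong (_* eval (divByLinear c (a ∷ p)) u)
                  (solve 2 (λ c t → con 1ℤ :+ t := (c :+ con 1ℤ :+ t) :+ :- c) refl c (+ t)) ⟩
        (u - c) * eval (divByLinear c (a ∷ p)) u
          ≡⟨ sym (ℤ.+-identityʳ _) ⟩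
        (u - c) * eval (divByLinear c (a ∷ p)) u + 0ℤ
          ≡⟨ cong (λ r → (u - c) * eval (divByLinear c (a ∷ p)) u + r) (sym root-c) ⟩
        (u - c) * eval (divByLinear c (a ∷ p)) u + eval (a ∷ p) c
          ≡⟨ sym (eval-divByLinear c (a ∷ p) u) ⟩
        eval (a ∷ p) u
          ≡⟨ cong (eval (a ∷ p)) (ℤ.+-assoc c 1ℤ (+ t)) ⟩
        eval (a ∷ p) (c + + suc t)
          ≡⟨ roots (suc t) ⟩
        0ℤ ∎
        where open ≡-Reasoning
    ... | inj₂ quotient≡0 = quotient≡0

  coeff-+P : ∀ p q k → coeff (p +P q) k ≡ coeff p k + coeff q k
  coeff-+P []      q       k       = sym (ℤ.+-identityˡ _)
  coeff-+P (a ∷ p) []      k       = sym (ℤ.+-identityʳ _)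
  coeff-+P (a ∷ p) (b ∷ q) zero    = refl
  coeff-+P (a ∷ p) (b ∷ q) (suc k) = coeff-+P p q k

  coeff-negP : ∀ p k → coeff (negP p) k ≡ - coeff p k
  coeff-negP []      k       = refl
  coeff-negP (a ∷ p) zero    = refl
  coeff-negP (a ∷ p) (suc k) = coeff-negP p k

  ≈P-from-eval : ∀ p q → (∀ t → eval p t ≡ eval q t) → p ≈P q
  ≈P-from-eval p q p≗q k = begin
    coeff p k                                 ≡⟨ solve 2 (λ x y → x := (x :+ :- y) :+ y) refl (coeff p k) (coeff q k) ⟩
    coeff p k + - coeff q k + coeff q k       ≡⟨ cong (_+ coeff q k) (sym coeff-difference) ⟩
    coeff difference k + coeff q k            ≡⟨ cong (_+ coeff q k) (coeff-zero-from-roots _ difference ℕ.≤-refl 0ℤ roots k) ⟩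
    0ℤ + coeff q k                            ≡⟨ ℤ.+-identityˡ _ ⟩
    coeff q k                                 ∎
    where
    open ≡-Reasoning
    difference = p +P negP q
    coeff-difference : coeff difference k ≡ coeff p k + - coeff q k
    coeff-difference = trans (coeff-+P p (negP q) k) (cong (λ r → coeff p k + r) (coeff-negP q k))
    roots : ∀ (t : ℕ) → eval difference (0ℤ + + t) ≡ 0ℤ
    roots t = begin
      eval difference (0ℤ + + t)                    ≡⟨ eval-+P p (negP q) _ ⟩
      eval p (0ℤ + + t) + eval (negP q) (0ℤ + + t)  ≡⟨ cong₂ _+_ (p≗q _) (eval-negP q _) ⟩
      eval q (0ℤ + + t) + - eval q (0ℤ + + t)       ≡⟨ ℤ.+-inverseʳ (eval q (0ℤ + + t)) ⟩
      0ℤ                                            ∎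

module Congruence (m : ℕ) where

  open import Data.Nat using (suc; _+_; _*_; _∸_; _%_; _/_; _<_; _≤_; _≡ᵇ_)
  import Data.Nat.Properties as ℕ
  open import Data.Nat.Properties using (≡ᵇ⇒≡; ≡⇒≡ᵇ)
  open import Data.Nat.DivMod using (%-distribˡ-+; %-distribˡ-*; m%n%n≡m%n; m<n⇒m%n≡m; m%n<n; [m+kn]%n≡m%n; m≡m%n+[m/n]*n)
  open import Data.Nat.Divisibility using (_∣_; _∣0; ∣1⇒≡1; ∣m∣n⇒∣m+n; ∣m+n∣m⇒∣n; ∣-trans; ∣n⇒∣m*n)
  open import Data.Nat.GCD using (gcd; gcd[m,n]∣m; gcd[m,n]∣n; gcd-greatest; module Bézout)
  open import Data.Nat.Coprimality using (Coprime; coprime-Bézout)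
  open import Data.Nat.Primality using (Prime; prime⇒irreducible)
  open import Data.Nat.Solver using (module +-*-Solver)
  open import Relation.Binary using (Setoid; IsEquivalence)
  open import Data.Bool using (Bool; true; false; _∨_; T)
  open import Data.Product using (_,_; Σ-syntax)
  open import Relation.Nullary using (¬_)
  open import Data.Bool.Properties using (T-∨)
  open import Data.Sum as Sum using (_⊎_; inj₁; inj₂)
  open import Data.Empty using (⊥-elim)
  open import Function using (_⇔_; mk⇔; Equivalence; _∘_)
  open import Relation.Binary.PropositionalEquality
  open +-*-Solver using (solve; _:+_; _:*_; _:=_; con)

  n : ℕ
  n = suc (suc m)

  infix 4 _≈_

  -- A record rather than the bare equation x % n ≡ y % n, so that x and y stay inferable.
  record _≈_ (x y : ℕ) : Set where
    constructor mod≡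
    field %≡% : x % n ≡ y % n

  open _≈_ public

  ≈-isEquivalence : IsEquivalence _≈_
  ≈-isEquivalence = record
    { refl  = mod≡ refl
    ; sym   = λ (mod≡ e) → mod≡ (sym e)
    ; trans = λ (mod≡ e) (mod≡ f) → mod≡ (trans e f)
    }

  ≈-setoid : Setoid _ _
  ≈-setoid = record { isEquivalence = ≈-isEquivalence }

  open IsEquivalence ≈-isEquivalence public using () renaming (refl to ≈-refl; sym to ≈-sym; trans to ≈-trans)

  ≡⇒≈ : ∀ {x y} → x ≡ y → x ≈ y
  ≡⇒≈ refl = ≈-refl

  ≈-+ : ∀ {x x′ y y′} → x ≈ x′ → y ≈ y′ → x + y ≈ x′ + y′
  ≈-+ {x} {x′} {y} {y′} (mod≡ x≈x′) (mod≡ y≈y′) =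
    mod≡ (trans (%-distribˡ-+ x y n) (trans (cong₂ (λ a b → (a + b) % n) x≈x′ y≈y′) (sym (%-distribˡ-+ x′ y′ n))))

  ≈-* : ∀ {x x′ y y′} → x ≈ x′ → y ≈ y′ → x * y ≈ x′ * y′
  ≈-* {x} {x′} {y} {y′} (mod≡ x≈x′) (mod≡ y≈y′) =
    mod≡ (trans (%-distribˡ-* x y n) (trans (cong₂ (λ a b → (a * b) % n) x≈x′ y≈y′) (sym (%-distribˡ-* x′ y′ n))))

  %-≈ : ∀ x → x % n ≈ x
  %-≈ x = mod≡ (m%n%n≡m%n x n)

  +*n-≈ : ∀ x z → x + z * n ≈ x
  +*n-≈ x z = mod≡ ([m+kn]%n≡m%n x z n)

  ≈⇒≡ : ∀ {x y} → x < n → y < n → x ≈ y → x ≡ y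
  ≈⇒≡ x<n y<n (mod≡ x≈y) = trans (sym (m<n⇒m%n≡m x<n)) (trans x≈y (m<n⇒m%n≡m y<n))

  ≈-complement : ∀ {x y a b} → x + y ≈ 0 → x ≈ a → a + b ≡ n → y ≈ b
  ≈-complement {x} {y} {a} {b} x+y≈0 x≈a a+b≡n = begin
    y                 ≈⟨ ≈-sym (+*n-≈ y 1) ⟩
    y + 1 * n         ≡⟨ cong (y +_) (trans (ℕ.*-identityˡ n) (sym a+b≡n)) ⟩
    y + (a + b)       ≡⟨ solve 3 (λ y a b → y :+ (a :+ b) := (a :+ y) :+ b) refl y a b ⟩
    a + y + b         ≈⟨ ≈-+ (≈-+ (≈-sym x≈a) ≈-refl) ≈-refl ⟩
    x + y + b         ≈⟨ ≈-+ x+y≈0 ≈-refl ⟩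
    b                 ∎
    where open import Relation.Binary.Reasoning.Setoid ≈-setoid

  negN<n : ∀ x → negN n x < n
  negN<n x = m%n<n (n ∸ x) n

  +-≈0⇒≡negN : ∀ {x y} → x < n → y < n → x + y ≈ 0 → x ≡ negN n y
  +-≈0⇒≡negN {x} {y} x<n y<n x+y≈0 = ≈⇒≡ x<n (negN<n y) (≈-trans x≈n∸y (≈-sym (%-≈ (n ∸ y))))
    where
    x≈n∸y : x ≈ n ∸ y
    x≈n∸y = ≈-complement (≈-trans (≡⇒≈ (ℕ.+-comm y x)) x+y≈0) ≈-refl (ℕ.m+[n∸m]≡n (ℕ.<⇒≤ y<n))

  negN-+-≈0 : ∀ x → x ≤ n → negN n x + x ≈ 0
  negN-+-≈0 x x≤n = ≈-trans (≈-+ (%-≈ (n ∸ x)) ≈-refl)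
    (≈-trans (≡⇒≈ (trans (ℕ.m∸n+n≡m x≤n) (sym (ℕ.+-identityʳ n)))) (+*n-≈ 0 1))

  negN-involutive : ∀ x → x < n → negN n (negN n x) ≡ x
  negN-involutive x x<n =
    sym (+-≈0⇒≡negN x<n (negN<n x) (≈-trans (≡⇒≈ (ℕ.+-comm x (negN n x))) (negN-+-≈0 x (ℕ.<⇒≤ x<n))))

  isUnitSign-cong : ∀ {x y} → x ≈ y → isUnitSign n x ≡ isUnitSign n y
  isUnitSign-cong (mod≡ x≈y) = cong (λ r → (r ≡ᵇ 1) ∨ (r ≡ᵇ suc m % n)) x≈y

  isUnitSign⇔ : ∀ x → T (isUnitSign n x) ⇔ (x ≈ 1 ⊎ x ≈ suc m)
  isUnitSign⇔ x = mk⇔ (Sum.map (mod≡ ∘ ≡ᵇ⇒≡ _ _) (mod≡ ∘ ≡ᵇ⇒≡ _ _) ∘ Equivalence.to T-∨)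
                      (Equivalence.from T-∨ ∘ Sum.map (≡⇒≡ᵇ _ _ ∘ %≡%) (≡⇒≡ᵇ _ _ ∘ %≡%))

  T-⇔⇒≡ : ∀ {a b : Bool} → (T a → T b) → (T b → T a) → a ≡ b
  T-⇔⇒≡ {false} {false} _ _ = refl
  T-⇔⇒≡ {false} {true}  _ b⇒a = ⊥-elim (b⇒a _)
  T-⇔⇒≡ {true}  {false} a⇒b _ = ⊥-elim (a⇒b _)
  T-⇔⇒≡ {true}  {true}  _ _ = refl

  isUnitSign-neg : ∀ x y → x + y ≈ 0 → isUnitSign n x ≡ isUnitSign n y
  isUnitSign-neg x y x+y≈0 =
    T-⇔⇒≡ (unit-of-opposite {x} {y} x+y≈0) (unit-of-opposite {y} {x} (≈-trans (≡⇒≈ (ℕ.+-comm y x)) x+y≈0))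
    where
    unit-of-opposite : ∀ {u v} → u + v ≈ 0 → T (isUnitSign n u) → T (isUnitSign n v)
    unit-of-opposite {u} {v} u+v≈0 unit with Equivalence.to (isUnitSign⇔ u) unit
    ... | inj₁ u≈1   = Equivalence.from (isUnitSign⇔ v) (inj₂ (≈-complement u+v≈0 u≈1 refl))
    ... | inj₂ u≈m+1 = Equivalence.from (isUnitSign⇔ v) (inj₁ (≈-complement u+v≈0 u≈m+1 (ℕ.+-comm (suc m) 1)))

  detCond-sym : ∀ a c b d → detCond n 1 (a , c) (b , d) ≡ detCond n 1 (b , d) (a , c)
  detCond-sym a c b d = isUnitSign-neg (a * d + suc m * (1 * (b * c))) (b * c + suc m * (1 * (a * d)))
    (≈-trans (≡⇒≈ multiple) (+*n-≈ 0 (a * d + b * c)))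
    where
    multiple : a * d + suc m * (1 * (b * c)) + (b * c + suc m * (1 * (a * d))) ≡ (a * d + b * c) * n
    multiple = solve 5 (λ a c b d m → a :* d :+ (con 1 :+ m) :* (con 1 :* (b :* c)) :+ (b :* c :+ (con 1 :+ m) :* (con 1 :* (a :* d)))
                                      := (a :* d :+ b :* c) :* (con 2 :+ m)) refl a c b d m

  detCond-negN : ∀ k a c b d → b ≤ n → d ≤ n → detCond n k (a , c) (negN n b , negN n d) ≡ detCond n k (a , c) (b , d)
  detCond-negN k a c b d b≤n d≤n = isUnitSign-neg (a * negN n d + suc m * (k * (negN n b * c))) (a * d + suc m * (k * (b * c))) (begin
    a * negN n d + suc m * (k * (negN n b * c)) + (a * d + suc m * (k * (b * c)))
      ≈⟨ ≈-+ (≈-+ (≈-* {a} ≈-refl (%-≈ (n ∸ d))) (≈-* {suc m} ≈-refl (≈-* {k} ≈-refl (≈-* (%-≈ (n ∸ b)) (≈-refl {c})))))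
             (≈-refl {a * d + suc m * (k * (b * c))}) ⟩
    a * (n ∸ d) + suc m * (k * ((n ∸ b) * c)) + (a * d + suc m * (k * (b * c)))
      ≡⟨ solve 8 (λ a u d m k v b c → a :* u :+ m :* (k :* (v :* c)) :+ (a :* d :+ m :* (k :* (b :* c)))
                                      := a :* (u :+ d) :+ m :* k :* c :* (v :+ b)) refl a (n ∸ d) d (suc m) k (n ∸ b) b c ⟩
    a * (n ∸ d + d) + suc m * k * c * (n ∸ b + b)
      ≡⟨ cong₂ (λ x y → a * x + suc m * k * c * y) (ℕ.m∸n+n≡m d≤n) (ℕ.m∸n+n≡m b≤n) ⟩
    a * n + suc m * k * c * n
      ≡⟨ sym (ℕ.*-distribʳ-+ n a (suc m * k * c)) ⟩
    (a + suc m * k * c) * n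
      ≈⟨ +*n-≈ 0 (a + suc m * k * c) ⟩
    0 ∎)
    where
    open import Relation.Binary.Reasoning.Setoid ≈-setoid

  ∣-respects-≈ : ∀ {g x y} → g ∣ n → x ≈ y → g ∣ x → g ∣ y
  ∣-respects-≈ {g} {x} {y} g∣n (mod≡ x≈y) g∣x =
    subst (g ∣_) (sym (m≡m%n+[m/n]*n y n)) (∣m∣n⇒∣m+n g∣y%n (∣n⇒∣m*n (y / n) g∣n))
    where
    g∣y%n : g ∣ y % n
    g∣y%n = subst (g ∣_) x≈y
      (∣m+n∣m⇒∣n (subst (g ∣_) (trans (m≡m%n+[m/n]*n x n) (ℕ.+-comm (x % n) _)) g∣x) (∣n⇒∣m*n (x / n) g∣n))

  ∣-negate : ∀ {g x y} → g ∣ n → x + y ≈ 0 → g ∣ x → g ∣ y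
  ∣-negate {g} {x} g∣n x+y≈0 g∣x = ∣m+n∣m⇒∣n (∣-respects-≈ g∣n (≈-sym x+y≈0) (g ∣0)) g∣x

  Coprime₃ : ℕ → ℕ → Set
  Coprime₃ a c = ∀ g → g ∣ a → g ∣ c → g ∣ n → g ≡ 1

  gcd≡1⇒Coprime₃ : ∀ a c → gcd (gcd a c) n ≡ 1 → Coprime₃ a c
  gcd≡1⇒Coprime₃ a c gcd≡1 g g∣a g∣c g∣n = ∣1⇒≡1 (subst (g ∣_) gcd≡1 (gcd-greatest (gcd-greatest g∣a g∣c) g∣n))

  Coprime₃⇒gcd≡1 : ∀ a c → Coprime₃ a c → gcd (gcd a c) n ≡ 1
  Coprime₃⇒gcd≡1 a c coprime = coprime _ (∣-trans (gcd[m,n]∣m (gcd a c) n) (gcd[m,n]∣m a c))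
                                       (∣-trans (gcd[m,n]∣m (gcd a c) n) (gcd[m,n]∣n a c)) (gcd[m,n]∣n (gcd a c) n)

  Coprime₃-negN : ∀ a c → a ≤ n → c ≤ n → Coprime₃ a c → Coprime₃ (negN n a) (negN n c)
  Coprime₃-negN a c a≤n c≤n coprime g g∣-a g∣-c g∣n =
    coprime g (∣-negate g∣n (negN-+-≈0 a a≤n) g∣-a) (∣-negate g∣n (negN-+-≈0 c c≤n) g∣-c) g∣n

  module Rescaling (k k′ : ℕ) (kk′≈1 : k * k′ ≈ 1) where

    k*k′*-≈ : ∀ x → k * (k′ * x) ≈ x
    k*k′*-≈ x = ≈-trans (≡⇒≈ (sym (ℕ.*-assoc k k′ x))) (≈-trans (≈-* kk′≈1 (≈-refl {x})) (≡⇒≈ (ℕ.*-identityˡ x)))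

    rescale : ℕ → ℕ
    rescale b = (k′ * b) % n

    rescale<n : ∀ b → rescale b < n
    rescale<n b = m%n<n (k′ * b) n

    k*rescale-≈ : ∀ b → k * rescale b ≈ b
    k*rescale-≈ b = ≈-trans (≈-* (≈-refl {k}) (%-≈ (k′ * b))) (k*k′*-≈ b)

    detCond-rescale : ∀ a c b d → detCond n k (a , c) (rescale b , d) ≡ detCond n 1 (a , c) (b , d)
    detCond-rescale a c b d = isUnitSign-cong (≈-+ (≈-refl {a * d}) (≈-* (≈-refl {suc m}) (begin
      k * (rescale b * c)   ≡⟨ sym (ℕ.*-assoc k (rescale b) c) ⟩
      k * rescale b * c     ≈⟨ ≈-* (k*rescale-≈ b) (≈-refl {c}) ⟩
      b * c                 ≡⟨ sym (ℕ.*-identityˡ (b * c)) ⟩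
      1 * (b * c)           ∎)))
      where open import Relation.Binary.Reasoning.Setoid ≈-setoid

    rescale-injective : ∀ {x y} → x < n → y < n → rescale x ≡ rescale y → x ≡ y
    rescale-injective x<n y<n e =
      ≈⇒≡ x<n y<n (≈-trans (≈-sym (k*rescale-≈ _)) (≈-trans (≈-* (≈-refl {k}) (≡⇒≈ e)) (k*rescale-≈ _)))

    rescale-negN-injective : ∀ {x y} → x < n → y < n → rescale x ≡ negN n (rescale y) → x ≡ negN n y
    rescale-negN-injective {x} {y} x<n y<n e = +-≈0⇒≡negN x<n y<n (begin
      x + y                                   ≈⟨ ≈-+ (≈-sym (k*rescale-≈ x)) (≈-sym (k*rescale-≈ y)) ⟩
      k * rescale x + k * rescale y           ≡⟨ cong (λ r → k * r + k * rescale y) e ⟩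
      k * negN n (rescale y) + k * rescale y  ≡⟨ sym (ℕ.*-distribˡ-+ k (negN n (rescale y)) (rescale y)) ⟩
      k * (negN n (rescale y) + rescale y)    ≈⟨ ≈-* (≈-refl {k}) (negN-+-≈0 (rescale y) (ℕ.<⇒≤ (rescale<n y))) ⟩
      k * 0                                   ≡⟨ ℕ.*-zeroʳ k ⟩
      0                                       ∎)
      where open import Relation.Binary.Reasoning.Setoid ≈-setoid

    Coprime₃-rescale : ∀ b d → Coprime₃ b d → Coprime₃ (rescale b) d
    Coprime₃-rescale b d coprime g g∣b′ g∣d g∣n =
      coprime g (∣-respects-≈ g∣n (k*rescale-≈ b) (∣n⇒∣m*n k g∣b′)) g∣d g∣n

  coprime⇒invertible : ∀ {k} → Coprime k n → Σ[ k′ ∈ ℕ ] k * k′ ≈ 1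
  coprime⇒invertible {k} coprime with coprime-Bézout coprime
  ... | Bézout.+- x y 1+yn≡xk = x , (begin
    k * x        ≡⟨ trans (ℕ.*-comm k x) (sym 1+yn≡xk) ⟩
    1 + y * n    ≈⟨ +*n-≈ 1 y ⟩
    1            ∎)
    where open import Relation.Binary.Reasoning.Setoid ≈-setoid
  ... | Bézout.-+ x y 1+xk≡yn = x * suc m , (begin
    k * (x * suc m)    ≡⟨ solve 3 (λ k x m → k :* (x :* m) := (x :* k) :* m) refl k x (suc m) ⟩
    x * k * suc m      ≈⟨ ≈-* xk≈-1 (≈-refl {suc m}) ⟩
    suc m * suc m      ≡⟨ solve 1 (λ m → (con 1 :+ m) :* (con 1 :+ m) := con 1 :+ m :* (con 2 :+ m)) refl m ⟩
    1 + m * n          ≈⟨ +*n-≈ 1 m ⟩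
    1                  ∎)
    where
    open import Relation.Binary.Reasoning.Setoid ≈-setoid
    xk≈-1 : x * k ≈ suc m
    xk≈-1 = ≈-complement (≈-trans (≡⇒≈ 1+xk≡yn) (≈-trans (≡⇒≈ (sym (ℕ.+-identityˡ (y * n)))) (+*n-≈ 0 y)))
                         ≈-refl refl

  prime∤⇒coprime : ∀ {p} → Prime p → ¬ p ∣ n → Coprime p n
  prime∤⇒coprime p-prime p∤n (d∣p , d∣n) with prime⇒irreducible p-prime d∣p
  ... | inj₁ d≡1    = d≡1
  ... | inj₂ refl   = ⊥-elim (p∤n d∣n)

module Vertices (m : ℕ) where

  open import Data.Nat using (suc; _*_; _<_; _≤_)
  import Data.Nat.Properties as ℕ
  open import Data.Bool using (true; false; T; if_then_else_)
  open import Data.Bool.Properties using (T-∧; T-∨)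
  open import Data.Product using (_×_; _,_; proj₁; proj₂)
  open import Data.Sum as Sum using (_⊎_; inj₁; inj₂)
  open import Data.Empty using (⊥-elim)
  open import Data.Fin using (Fin; zero; suc)
  open import Data.List using (List; []; _∷_; map; concatMap; upTo; lookup; cartesianProduct; _++_)
  open import Data.List.Membership.Propositional using (_∈_)
  open import Data.List.Membership.Propositional.Properties
    using (∈-lookup; ∈-filter⁺; ∈-filter⁻; ∈-cartesianProduct⁺; ∈-cartesianProduct⁻; ∈-upTo⁺; ∈-upTo⁻)
  open import Data.List.Relation.Unary.Any using (index)
  open import Data.List.Relation.Unary.Any.Properties using (lookup-index)
  import Data.List.Relation.Unary.All as All
  open import Data.List.Relation.Unary.AllPairs using (_∷_)
  open import Data.List.Relation.Unary.Unique.Propositional using (Unique)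
  import Data.List.Relation.Unary.Unique.Propositional.Properties as Unique
  open import Function using (_⇔_; mk⇔; Equivalence; _∘_)
  open import Function.Definitions using (Injective)
  open import Relation.Binary using (tri<; tri≈; tri>)
  open import Relation.Binary.PropositionalEquality
  open import Relation.Nullary using (¬_)
  open import Relation.Nullary.Decidable using (T?)
  open Congruence m

  lexLe⇔ : ∀ a c a′ c′ → T (lexLe (a , c) (a′ , c′)) ⇔ (a < a′ ⊎ (a ≡ a′ × c ≤ c′))
  lexLe⇔ a c a′ c′ = mk⇔
    (Sum.map (ℕ.<ᵇ⇒< a a′) (λ t → ℕ.≡ᵇ⇒≡ a a′ (proj₁ (Equivalence.to T-∧ t)) , ℕ.≤ᵇ⇒≤ c c′ (proj₂ (Equivalence.to T-∧ t)))
       ∘ Equivalence.to T-∨)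
    (Equivalence.from T-∨ ∘ Sum.map ℕ.<⇒<ᵇ (λ (a≡a′ , c≤c′) → Equivalence.from T-∧ (ℕ.≡⇒≡ᵇ a a′ a≡a′ , ℕ.≤⇒≤ᵇ c≤c′)))

  lexLe-total : ∀ p q → ¬ T (lexLe p q) → T (lexLe q p)
  lexLe-total (a , c) (a′ , c′) p≰q with ℕ.<-cmp a a′
  ... | tri< a<a′ _ _ = ⊥-elim (p≰q (Equivalence.from (lexLe⇔ a c a′ c′) (inj₁ a<a′)))
  ... | tri> _ _ a′<a = Equivalence.from (lexLe⇔ a′ c′ a c) (inj₁ a′<a)
  ... | tri≈ _ refl _ with ℕ.≤-total c c′
  ...   | inj₁ c≤c′ = ⊥-elim (p≰q (Equivalence.from (lexLe⇔ a c a c′) (inj₂ (refl , c≤c′))))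
  ...   | inj₂ c′≤c = Equivalence.from (lexLe⇔ a c′ a c) (inj₂ (refl , c′≤c))

  lexLe-antisym : ∀ p q → T (lexLe p q) → T (lexLe q p) → p ≡ q
  lexLe-antisym (a , c) (a′ , c′) p≤q q≤p
    with Equivalence.to (lexLe⇔ a c a′ c′) p≤q | Equivalence.to (lexLe⇔ a′ c′ a c) q≤p
  ... | inj₁ a<a′         | inj₁ a′<a         = ⊥-elim (ℕ.<-asym a<a′ a′<a)
  ... | inj₁ a<a′         | inj₂ (a′≡a , _)   = ⊥-elim (ℕ.<-irrefl (sym a′≡a) a<a′)
  ... | inj₂ (a≡a′ , _)   | inj₁ a′<a         = ⊥-elim (ℕ.<-irrefl (sym a≡a′) a′<a)
  ... | inj₂ (refl , c≤c′) | inj₂ (_ , c′≤c)  = cong (a ,_) (ℕ.≤-antisym c≤c′ c′≤c)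

  neg : ℕ × ℕ → ℕ × ℕ
  neg (a , c) = negN n a , negN n c

  Bounded : ℕ × ℕ → Set
  Bounded (a , c) = a < n × c < n

  neg-bounded : ∀ p → Bounded (neg p)
  neg-bounded (a , c) = negN<n a , negN<n c

  neg-involutive : ∀ p → Bounded p → neg (neg p) ≡ p
  neg-involutive (a , c) (a<n , c<n) = cong₂ _,_ (negN-involutive a a<n) (negN-involutive c c<n)

  isCanonical⇔ : ∀ a c → T (isCanonical n (a , c)) ⇔ (Coprime₃ a c × T (lexLe (a , c) (neg (a , c))))
  isCanonical⇔ a c = mk⇔
    (λ t → gcd≡1⇒Coprime₃ a c (ℕ.≡ᵇ⇒≡ _ 1 (proj₁ (Equivalence.to T-∧ t))) , proj₂ (Equivalence.to T-∧ t))
    (λ (coprime , lex) → Equivalence.from T-∧ (ℕ.≡⇒≡ᵇ _ 1 (Coprime₃⇒gcd≡1 a c coprime) , lex))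

  canon : ℕ × ℕ → ℕ × ℕ
  canon p = if lexLe p (neg p) then p else neg p

  canon-cases : ∀ p → (canon p ≡ p × T (lexLe p (neg p))) ⊎ (canon p ≡ neg p × ¬ T (lexLe p (neg p)))
  canon-cases p with lexLe p (neg p)
  ... | true  = inj₁ (refl , _)
  ... | false = inj₂ (refl , λ ())

  canon-bounded : ∀ p → Bounded p → Bounded (canon p)
  canon-bounded p bounded with canon-cases p
  ... | inj₁ (refl′ , _) rewrite refl′ = bounded
  ... | inj₂ (neg′ , _)  rewrite neg′ = neg-bounded p

  canon-canonical : ∀ a c → Bounded (a , c) → Coprime₃ a c → T (isCanonical n (canon (a , c)))
  canon-canonical a c (a<n , c<n) coprime with canon-cases (a , c)
  ... | inj₁ (e , lex) rewrite e = Equivalence.from (isCanonical⇔ a c) (coprime , lex)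
  ... | inj₂ (e , ¬lex) rewrite e = Equivalence.from (isCanonical⇔ (negN n a) (negN n c))
    (Coprime₃-negN a c (ℕ.<⇒≤ a<n) (ℕ.<⇒≤ c<n) coprime ,
     subst (T ∘ lexLe (neg (a , c))) (sym (neg-involutive (a , c) (a<n , c<n))) (lexLe-total (a , c) (neg (a , c)) ¬lex))

  canon-injective : ∀ p q → Bounded p → Bounded q → canon p ≡ canon q → p ≡ q ⊎ p ≡ neg q
  canon-injective p q bp bq e with canon-cases p | canon-cases q
  ... | inj₁ (ep , _) | inj₁ (eq , _) = inj₁ (trans (sym ep) (trans e eq))
  ... | inj₁ (ep , _) | inj₂ (eq , _) = inj₂ (trans (sym ep) (trans e eq))
  ... | inj₂ (ep , _) | inj₁ (eq , _) = inj₂ (trans (sym (neg-involutive p bp)) (cong neg (trans (sym ep) (trans e eq))))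
  ... | inj₂ (ep , _) | inj₂ (eq , _) =
    inj₁ (trans (sym (neg-involutive p bp)) (trans (cong neg (trans (sym ep) (trans e eq))) (neg-involutive q bq)))

  canonical-neg-unique : ∀ p q → Bounded q → T (lexLe p (neg p)) → T (lexLe q (neg q)) → p ≡ neg q → p ≡ q
  canonical-neg-unique p q bq p≤-p q≤-q p≡-q = lexLe-antisym p q
    (subst (T ∘ lexLe p) (trans (cong neg p≡-q) (neg-involutive q bq)) p≤-p)
    (subst (T ∘ lexLe q) (sym p≡-q) q≤-q)

  concatMap≡cartesianProduct : ∀ {A B : Set} (xs : List A) (ys : List B) →
    concatMap (λ a → map (a ,_) ys) xs ≡ cartesianProduct xs ys
  concatMap≡cartesianProduct []       ys = refl
  concatMap≡cartesianProduct (x ∷ xs) ys = cong (map (x ,_) ys ++_) (concatMap≡cartesianProduct xs ys)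

  ∈-allPairs⁻ : ∀ p → p ∈ allPairs n → Bounded p
  ∈-allPairs⁻ p p∈
    with ∈-cartesianProduct⁻ (upTo n) (upTo n) (subst (p ∈_) (concatMap≡cartesianProduct (upTo n) (upTo n)) p∈)
  ... | a∈ , c∈ = ∈-upTo⁻ a∈ , ∈-upTo⁻ c∈

  ∈-allPairs⁺ : ∀ p → Bounded p → p ∈ allPairs n
  ∈-allPairs⁺ p (a<n , c<n) =
    subst (p ∈_) (sym (concatMap≡cartesianProduct (upTo n) (upTo n))) (∈-cartesianProduct⁺ (∈-upTo⁺ a<n) (∈-upTo⁺ c<n))

  allPairs-unique : Unique (allPairs n)
  allPairs-unique = subst Unique (sym (concatMap≡cartesianProduct (upTo n) (upTo n)))
                          (Unique.cartesianProduct⁺ (Unique.upTo⁺ n) (Unique.upTo⁺ n))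

  lookup-injective : ∀ {A : Set} (xs : List A) → Unique xs → ∀ i j → lookup xs i ≡ lookup xs j → i ≡ j
  lookup-injective (x ∷ xs) (x∉xs ∷ unique) zero    zero    _ = refl
  lookup-injective (x ∷ xs) (x∉xs ∷ unique) zero    (suc j) e = ⊥-elim (All.lookup x∉xs (∈-lookup j) e)
  lookup-injective (x ∷ xs) (x∉xs ∷ unique) (suc i) zero    e = ⊥-elim (All.lookup x∉xs (∈-lookup i) (sym e))
  lookup-injective (x ∷ xs) (x∉xs ∷ unique) (suc i) (suc j) e = cong suc (lookup-injective xs unique i j e)

  private
    canonical? = T? ∘ isCanonical n

  vtx-injective : Injective _≡_ _≡_ (vtx n)
  vtx-injective = lookup-injective (vertexList n) (Unique.filter⁺ canonical? allPairs-unique) _ _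

  vtx-bounded : ∀ o → Bounded (vtx n o)
  vtx-bounded o = ∈-allPairs⁻ (vtx n o) (proj₁ (∈-filter⁻ canonical? {xs = allPairs n} (∈-lookup o)))

  vtx-canonical : ∀ o → Coprime₃ (proj₁ (vtx n o)) (proj₂ (vtx n o)) × T (lexLe (vtx n o) (neg (vtx n o)))
  vtx-canonical o = Equivalence.to (isCanonical⇔ _ _) (proj₂ (∈-filter⁻ canonical? {xs = allPairs n} (∈-lookup o)))

  vertexIndex : ∀ p → Bounded p → T (isCanonical n p) → Fin (N n)
  vertexIndex p bounded canonical = index (∈-filter⁺ canonical? (∈-allPairs⁺ p bounded) canonical)

  vtx-vertexIndex : ∀ p bounded canonical → vtx n (vertexIndex p bounded canonical) ≡ p
  vtx-vertexIndex p bounded canonical = sym (lookup-index (∈-filter⁺ canonical? (∈-allPairs⁺ p bounded) canonical))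

  detCond-vtx-sym : ∀ i j → detCond n 1 (vtx n i) (vtx n j) ≡ detCond n 1 (vtx n j) (vtx n i)
  detCond-vtx-sym i j = detCond-sym (proj₁ (vtx n i)) (proj₂ (vtx n i)) (proj₁ (vtx n j)) (proj₂ (vtx n j))

  module Relabel (k k′ : ℕ) (kk′≈1 : k * k′ ≈ 1) where

    open Rescaling k k′ kk′≈1

    rescaled : Fin (N n) → ℕ × ℕ
    rescaled o = rescale (proj₁ (vtx n o)) , proj₂ (vtx n o)

    rescaled-bounded : ∀ o → Bounded (rescaled o)
    rescaled-bounded o = rescale<n _ , proj₂ (vtx-bounded o)

    canon-rescaled-canonical : ∀ o → T (isCanonical n (canon (rescaled o)))
    canon-rescaled-canonical o = canon-canonical (rescale (proj₁ (vtx n o))) (proj₂ (vtx n o)) (rescaled-bounded o)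
      (Coprime₃-rescale (proj₁ (vtx n o)) (proj₂ (vtx n o)) (proj₁ (vtx-canonical o)))

    relabel : Fin (N n) → Fin (N n)
    relabel o = vertexIndex (canon (rescaled o)) (canon-bounded (rescaled o) (rescaled-bounded o)) (canon-rescaled-canonical o)

    vtx-relabel : ∀ o → vtx n (relabel o) ≡ canon (rescaled o)
    vtx-relabel o = vtx-vertexIndex (canon (rescaled o)) (canon-bounded (rescaled o) (rescaled-bounded o)) (canon-rescaled-canonical o)

    detCond-relabel : ∀ e o → detCond n k (vtx n e) (vtx n (relabel o)) ≡ detCond n 1 (vtx n e) (vtx n o)
    detCond-relabel e o = trans (cong (detCond n k (vtx n e)) (vtx-relabel o)) (by-sign (canon-cases (rescaled o)))
      where
      a = proj₁ (vtx n e)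
      c = proj₂ (vtx n e)
      b = proj₁ (vtx n o)
      d = proj₂ (vtx n o)
      r = rescaled o
      by-sign : (canon r ≡ r × T (lexLe r (neg r))) ⊎ (canon r ≡ neg r × ¬ T (lexLe r (neg r))) →
                  detCond n k (a , c) (canon r) ≡ detCond n 1 (a , c) (b , d)
      by-sign (inj₁ (same , _))     = trans (cong (detCond n k (a , c)) same) (detCond-rescale a c b d)
      by-sign (inj₂ (opposite , _)) = trans (cong (detCond n k (a , c)) opposite)
        (trans (detCond-negN k a c (rescale b) d (ℕ.<⇒≤ (rescale<n b)) (ℕ.<⇒≤ (proj₂ (vtx-bounded o))))
               (detCond-rescale a c b d))

    relabel-injective : Injective _≡_ _≡_ relabel
    relabel-injective {x} {y} e = Sum.[ same-case , opposite-case ]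
      (canon-injective (rescaled x) (rescaled y) (rescaled-bounded x) (rescaled-bounded y)
                       (trans (sym (vtx-relabel x)) (trans (cong (vtx n) e) (vtx-relabel y))))
      where
      bx = proj₁ (vtx-bounded x)
      by = proj₁ (vtx-bounded y)
      same-case : rescaled x ≡ rescaled y → x ≡ y
      same-case same = vtx-injective
        (cong₂ _,_ (rescale-injective bx by (cong proj₁ same)) (cong proj₂ same))
      opposite-case : rescaled x ≡ neg (rescaled y) → x ≡ y
      opposite-case opposite = vtx-injective
        (canonical-neg-unique (vtx n x) (vtx n y) (vtx-bounded y) (proj₂ (vtx-canonical x)) (proj₂ (vtx-canonical y))
          (cong₂ _,_ (rescale-negN-injective bx by (cong proj₁ opposite)) (cong proj₂ opposite)))

open import Data.Nat as ℕ using (zero; suc; s≤s; z≤n)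
open import Data.Nat.Primality using (Prime; prime[2]; prime?)
open import Data.Integer as ℤ using (ℤ; -_; 0ℤ; 1ℤ)
import Data.Integer.Properties as ℤ
open import Data.Integer.Solver using (module +-*-Solver)
open import Data.Bool using (Bool; true; false; if_then_else_)
open import Data.Fin using (splitAt; _≟_)
open import Data.Product using (_,_; proj₁; proj₂)
open import Data.Sum using (inj₁; inj₂)
open import Data.List using ([])
open import Relation.Binary.PropositionalEquality
open import Relation.Nullary.Decidable using (⌊_⌋; from-yes)
open +-*-Solver using (solve; _:*_; :-_; _:=_)
open Determinant
open Bipartite
open Evaluation

eval-charPoly-entry : ∀ (b : Bool) c t → eval ((if b then xP else []) +P constP c) t ≡ (if b then t else 0ℤ) ℤ.+ c
eval-charPoly-entry true  c t = trans (eval-+P xP (constP c) t) (cong₂ ℤ._+_ (eval-xP t) (eval-constP c t))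
eval-charPoly-entry false c t = trans (eval-constP c t) (sym (ℤ.+-identityˡ c))

eval-charPoly : ∀ G t → eval (charPoly G) t ≡ detℤ (V G) (charMatrix t (adjℤ G))
eval-charPoly G t = trans (eval-det (V G) _ t) (det-cong (V G) λ i j → eval-charPoly-entry ⌊ i ≟ j ⌋ (- adjℤ G i j) t)

det-charMatrix-neg : ∀ m (A : Matrix m) t →
  detℤ m (charMatrix (- t) A) ≡ signℤ m ℤ.* detℤ m (λ i j → scalar t i j ℤ.+ A i j)
det-charMatrix-neg m A t = trans (det-cong m entry) (det-neg m (λ i j → scalar t i j ℤ.+ A i j))
  where
  entry : ∀ i j → charMatrix (- t) A i j ≡ - (scalar t i j ℤ.+ A i j)
  entry i j with ⌊ i ≟ j ⌋
  ... | true  = sym (ℤ.neg-distrib-+ t (A i j))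
  ... | false = sym (ℤ.neg-distrib-+ 0ℤ (A i j))

signℤ-square : ∀ m → signℤ m ℤ.* signℤ m ≡ 1ℤ
signℤ-square zero    = refl
signℤ-square (suc m) = trans (solve 1 (λ s → :- s :* :- s := s :* s) refl (signℤ m)) (signℤ-square m)

module _ (m : ℕ) where

  open Congruence m using (n; _≈_; coprime⇒invertible; prime∤⇒coprime)
  open Vertices m using (detCond-vtx-sym; module Relabel)

  adjacency : ℕ → Matrix (N n)
  adjacency k e o = if detCond n k (vtx n e) (vtx n o) then ℤ.+ 1 else 0ℤ

  adjℤ-Gk : ∀ k i j → adjℤ (Gk k n) i j ≡ bipartite (adjacency k) i j
  adjℤ-Gk k i j with splitAt (N n) i | splitAt (N n) j
  ... | inj₁ _ | inj₁ _ = refl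
  ... | inj₁ _ | inj₂ _ = refl
  ... | inj₂ _ | inj₁ _ = refl
  ... | inj₂ _ | inj₂ _ = refl

  module _ (k k′ : ℕ) (kk′≈1 : k ℕ.* k′ ≈ 1) where

    open Relabel k k′ kk′≈1

    adjacency-relabel : ∀ e o → adjacency k e (relabel o) ≡ adjacency 1 e o
    adjacency-relabel e o = cong (λ b → if b then ℤ.+ 1 else 0ℤ) (detCond-relabel e o)

    adjacency-sym : ∀ i j → adjacency 1 i j ≡ adjacency 1 j i
    adjacency-sym i j = cong (λ b → if b then ℤ.+ 1 else 0ℤ) (detCond-vtx-sym i j)

    spectrum-Gk : sp (Gk k n) ≈S (negSpec (N n) (sp3 n) ∪S sp3 n)
    spectrum-Gk = ≈P-from-eval (charPoly (Gk k n)) (negSpec (N n) (sp3 n) *P sp3 n) same-values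
      where
      A = adjacency 1
      s = signℤ (N n)
      χ = sp3 n
      same-values : ∀ t → eval (charPoly (Gk k n)) t ≡ eval (negSpec (N n) χ *P χ) t
      same-values t = begin
        eval (charPoly (Gk k n)) t
          ≡⟨ eval-charPoly (Gk k n) t ⟩
        detℤ (N n ℕ.+ N n) (charMatrix t (adjℤ (Gk k n)))
          ≡⟨ det-cong (N n ℕ.+ N n) (λ i j → cong (λ a → scalar t i j ℤ.+ - a) (adjℤ-Gk k i j)) ⟩
        detℤ (N n ℕ.+ N n) (charMatrix t (bipartite (adjacency k)))
          ≡⟨ det-charMatrix-bipartite-relabel A (adjacency k) relabel relabel-injective adjacency-relabel t ⟩
        detℤ (N n ℕ.+ N n) (charMatrix t (bipartite A))
          ≡⟨ det-charMatrix-bipartite A adjacency-sym t ⟩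
        minus ℤ.* plus
          ≡⟨ sign-twice ⟩
        s ℤ.* (s ℤ.* plus) ℤ.* minus
          ≡⟨ cong₂ (λ x y → s ℤ.* x ℤ.* y) (sym (det-charMatrix-neg (N n) A t)) (sym (eval-charPoly (G3 n) t)) ⟩
        s ℤ.* detℤ (N n) (charMatrix (- t) A) ℤ.* eval χ t
          ≡⟨ cong (λ x → s ℤ.* x ℤ.* eval χ t) (sym (trans (eval-negArg χ t) (eval-charPoly (G3 n) (- t)))) ⟩
        s ℤ.* eval (negArg χ) t ℤ.* eval χ t
          ≡⟨ cong (ℤ._* eval χ t) (sym (eval-scaleP s (negArg χ) t)) ⟩
        eval (negSpec (N n) χ) t ℤ.* eval χ t
          ≡⟨ sym (eval-*P (negSpec (N n) χ) χ t) ⟩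
        eval (negSpec (N n) χ *P χ) t ∎
        where
        open ≡-Reasoning
        minus = detℤ (N n) (charMatrix t A)
        plus = detℤ (N n) (λ i j → scalar t i j ℤ.+ A i j)
        sign-twice : minus ℤ.* plus ≡ s ℤ.* (s ℤ.* plus) ℤ.* minus
        sign-twice = begin
          minus ℤ.* plus                ≡⟨ sym (ℤ.*-identityˡ _) ⟩
          1ℤ ℤ.* (minus ℤ.* plus)       ≡⟨ cong (ℤ._* (minus ℤ.* plus)) (sym (signℤ-square (N n))) ⟩
          s ℤ.* s ℤ.* (minus ℤ.* plus)  ≡⟨ solve 3 (λ s x y → s :* s :* (x :* y) := s :* (s :* y) :* x) refl s minus plus ⟩
          s ℤ.* (s ℤ.* plus) ℤ.* minus  ∎

  spectrum-Gk-prime : ∀ {p} → Prime p → ¬ p ∣ n → sp (Gk p n) ≈S (negSpec (N n) (sp3 n) ∪S sp3 n)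
  spectrum-Gk-prime {p} p-prime p∤n = spectrum-Gk p (proj₁ inverse) (proj₂ inverse)
    where
    inverse = coprime⇒invertible (prime∤⇒coprime p-prime p∤n)

corollary9p2 : (n : ℕ) → 2 ≤ n →
    ((¬ (2 ∣ n)) → sp (G4 n) ≈S (negSpec (N n) (sp3 n) ∪S sp3 n))
    × ((¬ (3 ∣ n)) → sp (G6 n) ≈S (negSpec (N n) (sp3 n) ∪S sp3 n))
corollary9p2 (suc (suc m)) (s≤s (s≤s z≤n)) = spectrum-Gk-prime m prime[2] , spectrum-Gk-prime m (from-yes (prime? 3))
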